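{- For $n\ge1$, the map $\psi$ defined below is a bijection between the set of $2$-distant noncrossing partitions of $[n]$ and the set of plane binary trees with exactly $n$ unfulfilled vertices in which the left child of every fulfilled vertex has a left child. Moreover, if $\psi(\pi)=T$, then (i) the number of blocks of $\pi$ equals the number of leaves of $T$ plus the number of vertices of $T$ having only a left child, minus the number of fulfilled vertices of $T$; and (ii) the number of $1$-distant crossings of $\pi$ equals the number of pairs $(u,v)$ of fulfilled vertices of $T$ such that $v$ is the left child of $u$.
   Context: A partition of $[n]$ is a set of pairwise disjoint nonempty blocks with union $[n]$. A standard edge is a pair $(i,j)$, $i<j$, in the same block with no element of that block strictly between them. A $k$-distant crossing is a pair of standard edges $(i_1,j_1),(i_2,j_2)$ with $i_1<i_2<j_1<j_2$ and $j_1-i_2\ge k$; a partition is $k$-distant noncrossing if it has none. An element $i$ is a singleton if $\{i\}$ is a block. For $A=\{a_1<\dots<a_m\}\subseteq[n]$, $\pi\cap A$ is the partition of $[m]$ obtained by deleting elements not in $A$ and relabeling $a_i$ as $i$; $\pi\setminus j=\pi\cap([n]\setminus\{j\})$. A plane binary tree is an unlabeled rooted tree in which each non-leaf vertex has a left child, a right child, or both; a vertex is fulfilled if it has both children, unfulfilled otherwise. The map $\psi$: if $n=1$, $\psi(\pi)$ is the one-vertex tree. If $n\ge2$: (Case 1) if $n$ is a singleton of $\pi$, $\psi(\pi)$ is a root with only a left child, at which $\psi(\pi\setminus n)$ is attached; (Case 2) if $(n-1,n)$ is a standard edge, $\psi(\pi)$ is a root with only a right child, at which $\psi(\pi\setminus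 n)$ is attached; (Case 3) if $(i-1,n)$ is a standard edge for some $2\le i\le n-1$, $\psi(\pi)$ is a root with a left child at which $\psi(\pi\cap[i])$ is attached and a right child at which $\psi(\pi\cap\{i,i+1,\dots,n-1\})$ is attached. -}

module Defs where

open import Data.Nat using (ℕ; zero; suc; _+_; _∸_; _≤_; _<_; _≡ᵇ_; _<ᵇ_; _≤ᵇ_)
open import Data.Nat.Properties using (_≟_)
open import Data.Bool using (Bool; true; false; _∧_; not; if_then_else_; T)
open import Data.List using (List; []; _∷_; length; filter; concatMap; upTo; take; drop; foldl; map; deduplicate)
open import Data.Maybe using (Maybe; just; nothing)
open import Data.Product using (_×_; _,_)
open import Data.Unit using (⊤)
open import Data.Empty using (⊥)
open import Relation.Binary.PropositionalEquality using (_≡_)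
open import Relation.Nullary.Decidable using (⌊_⌋)

-- Set partitions of [n], encoded canonically as restricted growth
-- strings: a list w of length n, where the element i+1 of [n] sits at
-- position i, w[i] is the label of its block, and labels are assigned
-- 0,1,2,... in order of first occurrence.  This encoding is a bijection
-- with the set partitions of [n].

-- RGS' m w : w is a valid continuation when labels 0..m-1 are in use
RGS' : ℕ → List ℕ → Set
RGS' m []       = ⊤
RGS' m (x ∷ xs) = (x ≤ m) × RGS' (if x ≡ᵇ m then suc m else m) xs

IsPartition : ℕ → List ℕ → Set
IsPartition n w = (length w ≡ n) × RGS' 0 w

-- label of position i (default 0 outside range; only used in range)
at : List ℕ → ℕ → ℕ
at []       _       = 0
at (x ∷ xs) zero    = x
at (x ∷ xs) (suc i) = at xs i

-- all but the last entry (deleting the element n)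
init : List ℕ → List ℕ
init []           = []
init (x ∷ [])     = []
init (x ∷ y ∷ xs) = x ∷ init (y ∷ xs)

-- relabel an arbitrary label list into restricted growth form
-- (block labels renumbered in order of first occurrence)
lookupA : List (ℕ × ℕ) → ℕ → Maybe ℕ
lookupA []              _ = nothing
lookupA ((k , v) ∷ kvs) x = if k ≡ᵇ x then just v else lookupA kvs x

standardize' : List (ℕ × ℕ) → ℕ → List ℕ → List ℕ
standardize' env nxt []       = []
standardize' env nxt (x ∷ xs) with lookupA env x
... | just v  = v ∷ standardize' env nxt xs
... | nothing = nxt ∷ standardize' ((x , nxt) ∷ env) (suc nxt) xs

standardize : List ℕ → List ℕ
standardize = standardize' [] 0

numBlocks : List ℕ → ℕ
numBlocks w = length (deduplicate _≟_ w)

allᵇ : (ℕ → Bool) → List ℕ → Bool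
allᵇ p []       = true
allᵇ p (x ∷ xs) = p x ∧ allᵇ p xs

filterᵇ : {A : Set} → (A → Bool) → List A → List A
filterᵇ p []       = []
filterᵇ p (x ∷ xs) = if p x then x ∷ filterᵇ p xs else filterᵇ p xs

-- indices in the half-open range [a, b)
range : ℕ → ℕ → List ℕ
range a b = map (a +_) (upTo (b ∸ a))

-- (i , j) (0-based positions) is a standard edge: i < j, same block,
-- and no element of that block strictly between them
stdEdge : List ℕ → ℕ → ℕ → Bool
stdEdge w i j =
  (i <ᵇ j) ∧ (j <ᵇ length w) ∧ (at w i ≡ᵇ at w j)
  ∧ allᵇ (λ k → not (at w k ≡ᵇ at w i)) (range (suc i) j)

isCrossing : ℕ → List ℕ → ℕ × ℕ × ℕ × ℕ → Bool
isCrossing k w (i₁ , j₁ , i₂ , j₂) =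
  stdEdge w i₁ j₁ ∧ stdEdge w i₂ j₂
  ∧ (i₁ <ᵇ i₂) ∧ (i₂ <ᵇ j₁) ∧ (j₁ <ᵇ j₂) ∧ (k ≤ᵇ (j₁ ∸ i₂))

quads : ℕ → List (ℕ × ℕ × ℕ × ℕ)
quads n = concatMap (λ a → concatMap (λ b → concatMap (λ c →
            map (λ d → (a , b , c , d)) (upTo n)) (upTo n)) (upTo n)) (upTo n)

crossings : ℕ → List ℕ → List (ℕ × ℕ × ℕ × ℕ)
crossings k w = filterᵇ (isCrossing k w) (quads (length w))

numCrossings : ℕ → List ℕ → ℕ
numCrossings k w = length (crossings k w)

NonCrossing : ℕ → List ℕ → Set
NonCrossing k w = crossings k w ≡ []

data Tree : Set where
  leaf  : Tree
  onlyL : Tree → Tree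
  onlyR : Tree → Tree
  both  : Tree → Tree → Tree

unfulfilled : Tree → ℕ
unfulfilled leaf       = 1
unfulfilled (onlyL t)  = suc (unfulfilled t)
unfulfilled (onlyR t)  = suc (unfulfilled t)
unfulfilled (both l r) = unfulfilled l + unfulfilled r

fulfilled : Tree → ℕ
fulfilled leaf       = 0
fulfilled (onlyL t)  = fulfilled t
fulfilled (onlyR t)  = fulfilled t
fulfilled (both l r) = suc (fulfilled l + fulfilled r)

leaves : Tree → ℕ
leaves leaf       = 1
leaves (onlyL t)  = leaves t
leaves (onlyR t)  = leaves t
leaves (both l r) = leaves l + leaves r

onlyLeftCount : Tree → ℕ
onlyLeftCount leaf       = 0
onlyLeftCount (onlyL t)  = suc (onlyLeftCount t)
onlyLeftCount (onlyR t)  = onlyLeftCount t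
onlyLeftCount (both l r) = onlyLeftCount l + onlyLeftCount r

isFulfilled : Tree → ℕ
isFulfilled (both _ _) = 1
isFulfilled _          = 0

leftFulfilledPairs : Tree → ℕ
leftFulfilledPairs leaf       = 0
leftFulfilledPairs (onlyL t)  = leftFulfilledPairs t
leftFulfilledPairs (onlyR t)  = leftFulfilledPairs t
leftFulfilledPairs (both l r) = isFulfilled l + leftFulfilledPairs l + leftFulfilledPairs r

HasLeftChild : Tree → Set
HasLeftChild leaf       = ⊥
HasLeftChild (onlyL _)  = ⊤
HasLeftChild (onlyR _)  = ⊥
HasLeftChild (both _ _) = ⊤

LeftCond : Tree → Set
LeftCond leaf       = ⊤
LeftCond (onlyL t)  = LeftCond t
LeftCond (onlyR t)  = LeftCond t
LeftCond (both l r) = HasLeftChild l × LeftCond l × LeftCond r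

-- the largest position j < length w - 1 in the same block as the last
-- position (i.e. the partner of the standard edge ending at n), if any
prevOfLast : List ℕ → Maybe ℕ
prevOfLast w =
  foldl (λ acc j → if at w j ≡ᵇ at w (length w ∸ 1) then just j else acc)
        nothing (upTo (length w ∸ 1))

-- fuel-driven definition; fuel = n suffices since all recursive
-- arguments are strictly shorter
ψ-go : ℕ → List ℕ → Tree
ψ-go zero    w = leaf
ψ-go (suc f) w with length w ≤ᵇ 1 | prevOfLast w
... | true  | _       = leaf
... | false | nothing = onlyL (ψ-go f (init w))
... | false | just j  =
  if suc (suc j) ≡ᵇ length w
  then onlyR (ψ-go f (init w))
  else both (ψ-go f (take (suc (suc j)) w))                     -- Case 3, π ∩ [i], i = j+2
            (ψ-go f (standardize (drop (suc j) (init w))))      -- π ∩ {i,…,n-1}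

ψ : List ℕ → Tree
ψ w = ψ-go (length w) w

-- Run ψ on an arbitrary block relation on positions and induct along its three cases.
-- Cases 1 and 2 add the singleton n (a new block, an onlyL vertex) or the edge (n - 1, n)
-- (no new block, and no new 1-crossing since nothing fits between).  In Case 3, with (i - 1, n)
-- a standard edge, 2-distant noncrossing forces every block meeting both [i - 1] and
-- {i + 1, …, n - 1} to contain i.  So π is π ∩ [i] and π ∩ {i, …, n - 1} glued at i, with n
-- added to the block of i - 1; this gives injectivity, and conversely any two such partitions
-- glue, provided i - 1 and i lie in different blocks of π ∩ [i], which is the condition that the
-- left child of the new root has a left child.  Gluing merges exactly two blocks into one, and
-- the 1-crossings are those of both parts plus at most one straddling crossing, (j, i), (i - 1, n)
-- with j < i - 1, present iff ψ(π ∩ [i]) is fulfilled.  Positions below are 0-based.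

module Submission where

open import Defs
open import Data.Nat using (ℕ; zero; suc; _+_; _∸_; _≤_; _<_; _<?_; _≡ᵇ_; _<ᵇ_; _≤ᵇ_; z≤n; s≤s)
open import Data.Nat.Properties
open import Data.Nat.Tactic.RingSolver using (solve-∀)
open import Data.Bool using (Bool; true; false; _∧_; not; if_then_else_)
open import Data.Bool.Properties using (∧-zeroʳ; ∧-identityʳ; not-injective; ¬-not; not-¬; T-≡)
open import Function.Base using (case_of_)
open import Function.Bundles using (module Equivalence)
open import Data.List using (List; []; _∷_; length; upTo; applyUpTo; map; concatMap; _++_; foldl; take; drop; deduplicate; filter)
open import Data.List.Properties using (length-take; length-drop; map-applyUpTo; length-applyUpTo)
open import Data.Maybe using (Maybe; just; nothing)
open import Data.Maybe.Properties using (just-injective)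
open import Data.Product using (_×_; _,_; Σ; proj₁; proj₂)
open import Data.Sum using (_⊎_; inj₁; inj₂)
open import Data.Empty using (⊥; ⊥-elim)
open import Data.Unit using (tt)
open import Relation.Nullary using (¬_; yes; no; ¬?)
open import Relation.Binary.Definitions using (tri<; tri≈; tri>)
open import Relation.Binary.PropositionalEquality
open import Algebra.Properties.CommutativeSemigroup +-commutativeSemigroup using (interchange)


bool-ext : ∀ {a b : Bool} → (a ≡ true → b ≡ true) → (b ≡ true → a ≡ true) → a ≡ b
bool-ext {true} {true} f g = refl
bool-ext {true} {false} f g = sym (f refl)
bool-ext {false} {true} f g = g refl
bool-ext {false} {false} f g = refl

¬≡true⇒≡false : ∀ {b} → ¬ (b ≡ true) → b ≡ false
¬≡true⇒≡false = ¬-not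

≡false⇒¬≡true : ∀ {b} → b ≡ false → ¬ (b ≡ true)
≡false⇒¬≡true = not-¬

∧-elimˡ : ∀ {a b} → (a ∧ b) ≡ true → a ≡ true
∧-elimˡ {true} _ = refl
∧-elimʳ : ∀ {a b} → (a ∧ b) ≡ true → b ≡ true
∧-elimʳ {true} h = h
∧-intro : ∀ {a b} → a ≡ true → b ≡ true → (a ∧ b) ≡ true
∧-intro refl refl = refl

not-elim : ∀ {a} → not a ≡ true → a ≡ false
not-elim {false} _ = refl
not-intro : ∀ {a} → a ≡ false → not a ≡ true
not-intro refl = refl

≡ᵇ⇒≡′ : ∀ {m n} → (m ≡ᵇ n) ≡ true → m ≡ n
≡ᵇ⇒≡′ {m} {n} h = ≡ᵇ⇒≡ m n (Equivalence.from T-≡ h)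
≡⇒≡ᵇ′ : ∀ {m n} → m ≡ n → (m ≡ᵇ n) ≡ true
≡⇒≡ᵇ′ {m} {n} h = Equivalence.to T-≡ (≡⇒≡ᵇ m n h)
≡ᵇ-false⇒≢ : ∀ {m n} → (m ≡ᵇ n) ≡ false → m ≢ n
≡ᵇ-false⇒≢ h e with () ← trans (sym (≡⇒≡ᵇ′ e)) h
≢⇒≡ᵇ-false : ∀ {m n} → m ≢ n → (m ≡ᵇ n) ≡ false
≢⇒≡ᵇ-false h = ¬≡true⇒≡false (λ e → h (≡ᵇ⇒≡′ e))
≡ᵇ-refl : ∀ n → (n ≡ᵇ n) ≡ true
≡ᵇ-refl n = ≡⇒≡ᵇ′ {n} {n} refl

<ᵇ⇒<′ : ∀ {m n} → (m <ᵇ n) ≡ true → m < n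
<ᵇ⇒<′ {m} {n} h = <ᵇ⇒< m n (Equivalence.from T-≡ h)
<⇒<ᵇ′ : ∀ {m n} → m < n → (m <ᵇ n) ≡ true
<⇒<ᵇ′ h = Equivalence.to T-≡ (<⇒<ᵇ h)
≤ᵇ⇒≤′ : ∀ {m n} → (m ≤ᵇ n) ≡ true → m ≤ n
≤ᵇ⇒≤′ {m} {n} h = ≤ᵇ⇒≤ m n (Equivalence.from T-≡ h)
≤⇒≤ᵇ′ : ∀ {m n} → m ≤ n → (m ≤ᵇ n) ≡ true
≤⇒≤ᵇ′ h = Equivalence.to T-≡ (≤⇒≤ᵇ h)

if-true : ∀ {b} {A : Set} {x y : A} → b ≡ true → (if b then x else y) ≡ x
if-true refl = refl
if-false : ∀ {b} {A : Set} {x y : A} → b ≡ false → (if b then x else y) ≡ y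
if-false refl = refl

<∸⇒≤ : ∀ {x y} k → x < y ∸ k → k ≤ y
<∸⇒≤ {y = y} k x<y∸k with k ≤? y
... | yes k≤y = k≤y
... | no k≰y = ⊥-elim (<-irrefl refl (<-≤-trans (s≤s z≤n) (≤-trans x<y∸k (≤-reflexive (m≤n⇒m∸n≡0 (<⇒≤ (≰⇒> k≰y)))))))

<∸⇒+< : ∀ N k i → i < N ∸ k → k + i < N
<∸⇒+< N zero i h = h
<∸⇒+< (suc N) (suc k) i h = s≤s (<∸⇒+< N k i h)

<⇒≤∸1 : ∀ {d n} → d < n → d ≤ n ∸ 1
<⇒≤∸1 {d} {suc n} (s≤s h) = h

<∧≢∸1⇒<∸1 : ∀ {y n} → y < n → y ≢ n ∸ 1 → y < n ∸ 1
<∧≢∸1⇒<∸1 {y} {suc n} (s≤s y≤n) y≢ = ≤∧≢⇒< y≤n y≢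

<∸1⇒2+≤ : ∀ {j n} → j < n ∸ 1 → suc (suc j) ≤ n
<∸1⇒2+≤ {j} {suc n} h = s≤s h

shift-bound : ∀ n j i → i < n ∸ 1 ∸ suc j → suc j + i < n
shift-bound (suc n) j i h = m<n⇒m<1+n (<∸⇒+< n (suc j) i h)

ind : Bool → ℕ
ind true = 1
ind false = 0

sum< : ℕ → (ℕ → ℕ) → ℕ
sum< zero f = 0
sum< (suc n) f = f 0 + sum< n (λ i → f (suc i))

sum<-cong : ∀ n f g → (∀ i → i < n → f i ≡ g i) → sum< n f ≡ sum< n g
sum<-cong zero f g h = refl
sum<-cong (suc n) f g h = cong₂ _+_ (h 0 (s≤s z≤n)) (sum<-cong n _ _ (λ i i<n → h (suc i) (s≤s i<n)))

sum<-zero : ∀ n f → (∀ i → i < n → f i ≡ 0) → sum< n f ≡ 0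
sum<-zero zero f h = refl
sum<-zero (suc n) f h rewrite h 0 (s≤s z≤n) = sum<-zero n _ (λ i i<n → h (suc i) (s≤s i<n))

sum<≡0⇒ : ∀ n f → sum< n f ≡ 0 → ∀ i → i < n → f i ≡ 0
sum<≡0⇒ (suc n) f h zero _ = m+n≡0⇒m≡0 (f 0) h
sum<≡0⇒ (suc n) f h (suc i) (s≤s i<n) = sum<≡0⇒ n _ (m+n≡0⇒n≡0 (f 0) h) i i<n

sum<-+ : ∀ n f g → sum< n (λ i → f i + g i) ≡ sum< n f + sum< n g
sum<-+ zero f g = refl
sum<-+ (suc n) f g rewrite sum<-+ n (λ i → f (suc i)) (λ i → g (suc i)) =
  interchange (f 0) (g 0) (sum< n (λ i → f (suc i))) (sum< n (λ i → g (suc i)))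

sum<-split : ∀ m n f → sum< (m + n) f ≡ sum< m f + sum< n (λ i → f (m + i))
sum<-split zero n f = refl
sum<-split (suc m) n f rewrite sum<-split m n (λ i → f (suc i)) = sym (+-assoc (f 0) _ _)

sum<-last : ∀ n f → sum< (suc n) f ≡ sum< n f + f n
sum<-last n f = trans (cong (λ k → sum< k f) (+-comm 1 n)) (trans (sum<-split n 1 f) (cong (sum< n f +_) (trans (+-identityʳ (f (n + 0))) (cong f (+-identityʳ n)))))

sum<-truncate : ∀ m n f → m ≤ n → (∀ i → m ≤ i → i < n → f i ≡ 0) → sum< n f ≡ sum< m f
sum<-truncate zero n f _ h = sum<-zero n f (λ i i<n → h i z≤n i<n)
sum<-truncate (suc m) (suc n) f (s≤s m≤n) h =
  cong (f 0 +_) (sum<-truncate m n _ m≤n (λ i m≤i i<n → h (suc i) (s≤s m≤i) (s≤s i<n)))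

sum<-shift : ∀ k m f → (∀ i → i < k → f i ≡ 0) → sum< (k + m) f ≡ sum< m (λ i → f (k + i))
sum<-shift k m f h rewrite sum<-split k m f | sum<-zero k f h = refl

sum<-point : ∀ n f x → x < n → (∀ i → i < n → i ≢ x → f i ≡ 0) → sum< n f ≡ f x
sum<-point (suc n) f zero _ h = trans (cong (f 0 +_) (sum<-zero n _ (λ i i<n → h (suc i) (s≤s i<n) (λ ())))) (+-identityʳ _)
sum<-point (suc n) f (suc x) (s≤s x<n) h rewrite h 0 (s≤s z≤n) (λ ()) =
  sum<-point n _ x x<n (λ i i<n i≢x → h (suc i) (s≤s i<n) (λ e → i≢x (suc-injective e)))

length-filterᵇ-++ : ∀ {A : Set} (p : A → Bool) xs ys → length (filterᵇ p (xs ++ ys)) ≡ length (filterᵇ p xs) + length (filterᵇ p ys)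
length-filterᵇ-++ p [] ys = refl
length-filterᵇ-++ p (x ∷ xs) ys with p x
... | true = cong suc (length-filterᵇ-++ p xs ys)
... | false = length-filterᵇ-++ p xs ys

length-filterᵇ-concatMap : ∀ {A : Set} (p : A → Bool) (f : ℕ → List A) h n →
  length (filterᵇ p (concatMap f (applyUpTo h n))) ≡ sum< n (λ a → length (filterᵇ p (f (h a))))
length-filterᵇ-concatMap p f h zero = refl
length-filterᵇ-concatMap p f h (suc n) =
  trans (length-filterᵇ-++ p (f (h 0)) (concatMap f (applyUpTo (λ i → h (suc i)) n)))
        (cong (length (filterᵇ p (f (h 0))) +_) (length-filterᵇ-concatMap p f (λ i → h (suc i)) n))

length-filterᵇ-map : ∀ {A : Set} (p : A → Bool) (g : ℕ → A) h n →
  length (filterᵇ p (map g (applyUpTo h n))) ≡ sum< n (λ a → ind (p (g (h a))))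
length-filterᵇ-map p g h zero = refl
length-filterᵇ-map p g h (suc n) with p (g (h 0))
... | true = cong suc (length-filterᵇ-map p g (λ i → h (suc i)) n)
... | false = length-filterᵇ-map p g (λ i → h (suc i)) n

sum4< : ℕ → (ℕ → ℕ → ℕ → ℕ → ℕ) → ℕ
sum4< n g = sum< n λ a → sum< n λ b → sum< n λ c → sum< n λ d → g a b c d

count4 : ℕ → (ℕ × ℕ × ℕ × ℕ → Bool) → ℕ
count4 n p = sum4< n (λ a b c d → ind (p (a , b , c , d)))

length-filterᵇ-quads : ∀ n p → length (filterᵇ p (quads n)) ≡ count4 n p
length-filterᵇ-quads n p =
  trans (length-filterᵇ-concatMap p _ (λ x → x) n)
   (sum<-cong n _ _ λ a _ → trans (length-filterᵇ-concatMap p _ (λ x → x) n)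
   (sum<-cong n _ _ λ b _ → trans (length-filterᵇ-concatMap p _ (λ x → x) n)
   (sum<-cong n _ _ λ c _ → length-filterᵇ-map p _ (λ x → x) n)))

ind-false : ∀ {b} → (b ≡ true → ⊥) → ind b ≡ 0
ind-false {true} h = ⊥-elim (h refl)
ind-false {false} h = refl

sum4<-cong : ∀ n g h → (∀ a b c d → a < n → b < n → c < n → d < n → g a b c d ≡ h a b c d) → sum4< n g ≡ sum4< n h
sum4<-cong n g h e = sum<-cong n _ _ λ a a< → sum<-cong n _ _ λ b b< → sum<-cong n _ _ λ c c< → sum<-cong n _ _ λ d d< → e a b c d a< b< c< d<

sum4<-+ : ∀ n g h → sum4< n (λ a b c d → g a b c d + h a b c d) ≡ sum4< n g + sum4< n h
sum4<-+ n g h =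
  trans (sum<-cong n _ _ λ a _ → trans (sum<-cong n _ _ λ b _ → trans (sum<-cong n _ _ λ c _ → sum<-+ n _ _) (sum<-+ n _ _)) (sum<-+ n _ _))
        (sum<-+ n _ _)

sum4<-zero : ∀ n g → (∀ a b c d → a < n → b < n → c < n → d < n → g a b c d ≡ 0) → sum4< n g ≡ 0
sum4<-zero n g e = sum<-zero n _ λ a a< → sum<-zero n _ λ b b< → sum<-zero n _ λ c c< → sum<-zero n _ λ d d< → e a b c d a< b< c< d<

sum4<-truncate : ∀ m n g → m ≤ n →
  (∀ a b c d → a < n → b < n → c < n → d < n → (m ≤ a ⊎ m ≤ b ⊎ m ≤ c ⊎ m ≤ d) → g a b c d ≡ 0) →
  sum4< n g ≡ sum4< m g
sum4<-truncate m n g m≤n h =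
  trans (sum<-truncate m n _ m≤n (λ a m≤a a<n → sum<-zero n _ λ b b< → sum<-zero n _ λ c c< → sum<-zero n _ λ d d< → h a b c d a<n b< c< d< (inj₁ m≤a)))
  (sum<-cong m _ _ λ a a<m → let a<n = <-≤-trans a<m m≤n in
    trans (sum<-truncate m n _ m≤n (λ b m≤b b<n → sum<-zero n _ λ c c< → sum<-zero n _ λ d d< → h a b c d a<n b<n c< d< (inj₂ (inj₁ m≤b))))
    (sum<-cong m _ _ λ b b<m → let b<n = <-≤-trans b<m m≤n in
      trans (sum<-truncate m n _ m≤n (λ c m≤c c<n → sum<-zero n _ λ d d< → h a b c d a<n b<n c<n d< (inj₂ (inj₂ (inj₁ m≤c)))))
      (sum<-cong m _ _ λ c c<m → let c<n = <-≤-trans c<m m≤n in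
        sum<-truncate m n _ m≤n (λ d m≤d d<n → h a b c d a<n b<n c<n d<n (inj₂ (inj₂ (inj₂ m≤d)))))))

sum4<-shift : ∀ k m g →
  (∀ a b c d → a < k + m → b < k + m → c < k + m → d < k + m → (a < k ⊎ b < k ⊎ c < k ⊎ d < k) → g a b c d ≡ 0) →
  sum4< (k + m) g ≡ sum4< m (λ a b c d → g (k + a) (k + b) (k + c) (k + d))
sum4<-shift k m g h =
  trans (sum<-shift k m _ (λ a a<k → sum<-zero n _ λ b b< → sum<-zero n _ λ c c< → sum<-zero n _ λ d d< → h a b c d (lt a<k) b< c< d< (inj₁ a<k)))
  (sum<-cong m _ _ λ a a<m → let a' = +-monoʳ-< k a<m in
    trans (sum<-shift k m _ (λ b b<k → sum<-zero n _ λ c c< → sum<-zero n _ λ d d< → h _ b c d a' (lt b<k) c< d< (inj₂ (inj₁ b<k))))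
    (sum<-cong m _ _ λ b b<m → let b' = +-monoʳ-< k b<m in
      trans (sum<-shift k m _ (λ c c<k → sum<-zero n _ λ d d< → h _ _ c d a' b' (lt c<k) d< (inj₂ (inj₂ (inj₁ c<k)))))
      (sum<-cong m _ _ λ c c<m → let c' = +-monoʳ-< k c<m in
        sum<-shift k m _ (λ d d<k → h _ _ _ d a' b' c' (lt d<k) (inj₂ (inj₂ (inj₂ d<k)))))))
  where
  n = k + m
  lt : ∀ {x} → x < k → x < k + m
  lt x<k = <-≤-trans x<k (m≤m+n k m)

sum4<-point : ∀ n g a0 b0 c0 d0 → a0 < n → b0 < n → c0 < n → d0 < n →
  (∀ a b c d → a < n → b < n → c < n → d < n → (a ≢ a0 ⊎ b ≢ b0 ⊎ c ≢ c0 ⊎ d ≢ d0) → g a b c d ≡ 0) →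
  sum4< n g ≡ g a0 b0 c0 d0
sum4<-point n g a0 b0 c0 d0 a0< b0< c0< d0< h =
  trans (sum<-point n _ a0 a0< λ a a< a≢ → sum<-zero n _ λ b b< → sum<-zero n _ λ c c< → sum<-zero n _ λ d d< → h a b c d a< b< c< d< (inj₁ a≢))
  (trans (sum<-point n _ b0 b0< λ b b< b≢ → sum<-zero n _ λ c c< → sum<-zero n _ λ d d< → h a0 b c d a0< b< c< d< (inj₂ (inj₁ b≢)))
  (trans (sum<-point n _ c0 c0< λ c c< c≢ → sum<-zero n _ λ d d< → h a0 b0 c d a0< b0< c< d< (inj₂ (inj₂ (inj₁ c≢))))
  (sum<-point n _ d0 d0< λ d d< d≢ → h a0 b0 c0 d a0< b0< c0< d< (inj₂ (inj₂ (inj₂ d≢))))))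

allᵇ-map : ∀ p (g : ℕ → ℕ) xs → allᵇ p (map g xs) ≡ allᵇ (λ x → p (g x)) xs
allᵇ-map p g [] = refl
allᵇ-map p g (x ∷ xs) = cong (p (g x) ∧_) (allᵇ-map p g xs)

allᵇ-applyUpTo⁻ : ∀ p h n → allᵇ p (applyUpTo h n) ≡ true → ∀ i → i < n → p (h i) ≡ true
allᵇ-applyUpTo⁻ p h (suc n) e zero _ = ∧-elimˡ e
allᵇ-applyUpTo⁻ p h (suc n) e (suc i) (s≤s i<n) = allᵇ-applyUpTo⁻ p (λ x → h (suc x)) n (∧-elimʳ {p (h 0)} e) i i<n

allᵇ-applyUpTo⁺ : ∀ p h n → (∀ i → i < n → p (h i) ≡ true) → allᵇ p (applyUpTo h n) ≡ true
allᵇ-applyUpTo⁺ p h zero f = refl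
allᵇ-applyUpTo⁺ p h (suc n) f = ∧-intro (f 0 (s≤s z≤n)) (allᵇ-applyUpTo⁺ p (λ x → h (suc x)) n (λ i i<n → f (suc i) (s≤s i<n)))

allᵇ-upTo⁻ : ∀ p n → allᵇ p (upTo n) ≡ true → ∀ i → i < n → p i ≡ true
allᵇ-upTo⁻ p n e = allᵇ-applyUpTo⁻ p (λ x → x) n e

allᵇ-upTo⁺ : ∀ p n → (∀ i → i < n → p i ≡ true) → allᵇ p (upTo n) ≡ true
allᵇ-upTo⁺ p n = allᵇ-applyUpTo⁺ p (λ x → x) n

range≡applyUpTo : ∀ a b → range a b ≡ applyUpTo (a +_) (b ∸ a)
range≡applyUpTo a b = map-applyUpTo (λ x → x) (a +_) (b ∸ a)

allᵇ-range⁻ : ∀ p a b → allᵇ p (range a b) ≡ true → ∀ k → a ≤ k → k < b → p k ≡ true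
allᵇ-range⁻ p a b e k a≤k k<b =
  subst (λ x → p x ≡ true) (m+[n∸m]≡n a≤k)
    (allᵇ-applyUpTo⁻ p (a +_) (b ∸ a) (subst (λ l → allᵇ p l ≡ true) (range≡applyUpTo a b) e) (k ∸ a) (∸-monoˡ-< k<b a≤k))

allᵇ-range⁺ : ∀ p a b → (∀ k → a ≤ k → k < b → p k ≡ true) → allᵇ p (range a b) ≡ true
allᵇ-range⁺ p a b f =
  subst (λ l → allᵇ p l ≡ true) (sym (range≡applyUpTo a b))
    (allᵇ-applyUpTo⁺ p (a +_) (b ∸ a) (λ i i<b∸a → f (a + i) (m≤m+n a i) (<∸⇒+< b a i i<b∸a)))

BoolRel : Set
BoolRel = ℕ → ℕ → Bool

sameLabel : (ℕ → ℕ) → BoolRel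
sameLabel l x y = l x ≡ᵇ l y

sameBlock : List ℕ → BoolRel
sameBlock w = sameLabel (at w)

shiftRel : ℕ → BoolRel → BoolRel
shiftRel k s i j = s (k + i) (k + j)

_≈⟨_⟩_ : BoolRel → ℕ → BoolRel → Set
s ≈⟨ n ⟩ s' = ∀ i j → i < n → j < n → s i j ≡ s' i j

stdEdgeᴿ : ℕ → BoolRel → ℕ → ℕ → Bool
stdEdgeᴿ n s i j = (i <ᵇ j) ∧ (j <ᵇ n) ∧ s i j ∧ allᵇ (λ k → not (s k i)) (range (suc i) j)

isCrossingᴿ : ℕ → ℕ → BoolRel → ℕ × ℕ × ℕ × ℕ → Bool
isCrossingᴿ k n s (i₁ , j₁ , i₂ , j₂) =
  stdEdgeᴿ n s i₁ j₁ ∧ stdEdgeᴿ n s i₂ j₂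
  ∧ (i₁ <ᵇ i₂) ∧ (i₂ <ᵇ j₁) ∧ (j₁ <ᵇ j₂) ∧ (k ≤ᵇ (j₁ ∸ i₂))

lastPartnerᴿ : ℕ → BoolRel → Maybe ℕ
lastPartnerᴿ n s = foldl (λ acc j → if s j (n ∸ 1) then just j else acc) nothing (upTo (n ∸ 1))

-- ψ-go on an arbitrary block relation on positions 0 … n - 1: π ∩ [i] is truncation and
-- π ∩ {i, …, n - 1} is a shift, so the recursion needs no relabelling (standardize).
mutual
  ψᴿ : ℕ → ℕ → BoolRel → Tree
  ψᴿ zero n s = leaf
  ψᴿ (suc f) n s = ψᴿ-step f n s (n ≤ᵇ 1) (lastPartnerᴿ n s)

  ψᴿ-step : ℕ → ℕ → BoolRel → Bool → Maybe ℕ → Tree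
  ψᴿ-step f n s true _ = leaf
  ψᴿ-step f n s false nothing = onlyL (ψᴿ f (n ∸ 1) s)
  ψᴿ-step f n s false (just j) =
    if suc (suc j) ≡ᵇ n then onlyR (ψᴿ f (n ∸ 1) s)
    else both (ψᴿ f (suc (suc j)) s) (ψᴿ f (n ∸ 1 ∸ suc j) (shiftRel (suc j) s))

record StdEdge (n : ℕ) (s : BoolRel) (i j : ℕ) : Set where
  constructor mkE
  field
    e-lt : i < j
    e-bd : j < n
    e-same : s i j ≡ true
    e-gap : ∀ k → i < k → k < j → s k i ≡ false
open StdEdge public

stdEdge-sound : ∀ {n s i j} → stdEdgeᴿ n s i j ≡ true → StdEdge n s i j
stdEdge-sound {n} {s} {i} {j} e =
  mkE (<ᵇ⇒<′ (∧-elimˡ e)) (<ᵇ⇒<′ (∧-elimˡ (∧-elimʳ {i <ᵇ j} e))) (∧-elimˡ (∧-elimʳ {j <ᵇ n} (∧-elimʳ {i <ᵇ j} e)))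
      (λ k i<k k<j → not-elim (allᵇ-range⁻ _ (suc i) j (∧-elimʳ {s i j} (∧-elimʳ {j <ᵇ n} (∧-elimʳ {i <ᵇ j} e))) k i<k k<j))

stdEdge-complete : ∀ {n s i j} → StdEdge n s i j → stdEdgeᴿ n s i j ≡ true
stdEdge-complete {n} {s} {i} {j} (mkE a b c d) =
  ∧-intro (<⇒<ᵇ′ a) (∧-intro (<⇒<ᵇ′ b) (∧-intro c (allᵇ-range⁺ _ (suc i) j (λ k i<k k<j → not-intro (d k i<k k<j)))))

record Crossing (k n : ℕ) (s : BoolRel) (a b c d : ℕ) : Set where
  constructor mkC
  field
    c-e1 : StdEdge n s a b
    c-e2 : StdEdge n s c d
    c-ac : a < c
    c-cb : c < b
    c-bd : b < d
    c-k : k ≤ b ∸ c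
open Crossing public

isCrossing-sound : ∀ {k n s a b c d} → isCrossingᴿ k n s (a , b , c , d) ≡ true → Crossing k n s a b c d
isCrossing-sound {k} {n} {s} {a} {b} {c} {d} e =
  let e1 = ∧-elimˡ e ; r1 = ∧-elimʳ {stdEdgeᴿ n s a b} e
      e2 = ∧-elimˡ r1 ; r2 = ∧-elimʳ {stdEdgeᴿ n s c d} r1
      e3 = ∧-elimˡ r2 ; r3 = ∧-elimʳ {a <ᵇ c} r2
      e4 = ∧-elimˡ r3 ; r4 = ∧-elimʳ {c <ᵇ b} r3
      e5 = ∧-elimˡ r4 ; e6 = ∧-elimʳ {b <ᵇ d} r4
  in mkC (stdEdge-sound e1) (stdEdge-sound e2) (<ᵇ⇒<′ e3) (<ᵇ⇒<′ e4) (<ᵇ⇒<′ e5) (≤ᵇ⇒≤′ e6)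

isCrossing-complete : ∀ {k n s a b c d} → Crossing k n s a b c d → isCrossingᴿ k n s (a , b , c , d) ≡ true
isCrossing-complete (mkC e1 e2 ac cb bd kk) =
  ∧-intro (stdEdge-complete e1) (∧-intro (stdEdge-complete e2) (∧-intro (<⇒<ᵇ′ ac) (∧-intro (<⇒<ᵇ′ cb) (∧-intro (<⇒<ᵇ′ bd) (≤⇒≤ᵇ′ kk)))))

record IsEquivᵇ (s : BoolRel) : Set where
  constructor mkIsEquivᵇ
  field
    eq-refl : ∀ i → s i i ≡ true
    eq-sym : ∀ i j → s i j ≡ true → s j i ≡ true
    eq-trans : ∀ i j k → s i j ≡ true → s j k ≡ true → s i k ≡ true
open IsEquivᵇ public

sameLabel-equiv : ∀ l → IsEquivᵇ (sameLabel l)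
sameLabel-equiv l = mkIsEquivᵇ (λ i → ≡ᵇ-refl (l i))
               (λ i j e → ≡⇒≡ᵇ′ {l j} {l i} (sym (≡ᵇ⇒≡′ {l i} {l j} e)))
               (λ i j k e f → ≡⇒≡ᵇ′ {l i} {l k} (trans (≡ᵇ⇒≡′ {l i} e) (≡ᵇ⇒≡′ {l j} f)))

column-agree : ∀ {s} → IsEquivᵇ s → ∀ {j k} → s j k ≡ true → ∀ i → s i k ≡ s i j
column-agree E {j} {k} sjk i = bool-ext (λ e → eq-trans E i k j e (eq-sym E j k sjk)) (λ e → eq-trans E i j k e sjk)

shiftRel-equiv : ∀ {s} k → IsEquivᵇ s → IsEquivᵇ (shiftRel k s)
shiftRel-equiv k E = mkIsEquivᵇ (λ i → eq-refl E (k + i)) (λ i j → eq-sym E (k + i) (k + j)) (λ i j l → eq-trans E (k + i) (k + j) (k + l))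

stdEdge-unique-right : ∀ {n s i j j'} → IsEquivᵇ s → StdEdge n s i j → StdEdge n s i j' → j ≡ j'
stdEdge-unique-right {n} {s} {i} {j} {j'} E e e' with <-cmp j j'
... | tri≈ _ eq _ = eq
... | tri< j<j' _ _ = ⊥-elim (≡false⇒¬≡true (e-gap e' j (e-lt e) j<j') (eq-sym E i j (e-same e)))
... | tri> _ _ j'<j = ⊥-elim (≡false⇒¬≡true (e-gap e j' (e-lt e') j'<j) (eq-sym E i j' (e-same e')))

stdEdge-unique-left : ∀ {n s i i' j} → IsEquivᵇ s → StdEdge n s i j → StdEdge n s i' j → i ≡ i'
stdEdge-unique-left {n} {s} {i} {i'} {j} E e e' with <-cmp i i'
... | tri≈ _ eq _ = eq
... | tri< i<i' _ _ = ⊥-elim (≡false⇒¬≡true (e-gap e i' i<i' (e-lt e')) (eq-trans E i' j i (e-same e') (eq-sym E i j (e-same e))))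
... | tri> _ _ i'<i = ⊥-elim (≡false⇒¬≡true (e-gap e' i i'<i (e-lt e)) (eq-trans E i j i' (e-same e) (eq-sym E i' j (e-same e'))))

allᵇ-applyUpTo-false : ∀ p h n → allᵇ p (applyUpTo h n) ≡ false → Σ ℕ λ i → i < n × p (h i) ≡ false
allᵇ-applyUpTo-false p h (suc n) e with p (h 0) in e0
... | false = 0 , s≤s z≤n , e0
... | true with allᵇ-applyUpTo-false p (λ x → h (suc x)) n e
...   | i , i<n , pe = suc i , s≤s i<n , pe

allᵇ-range-false : ∀ p a b → allᵇ p (range a b) ≡ false → Σ ℕ λ k → a ≤ k × k < b × p k ≡ false
allᵇ-range-false p a b e with allᵇ-applyUpTo-false p (a +_) (b ∸ a) (subst (λ l → allᵇ p l ≡ false) (range≡applyUpTo a b) e)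
... | i , i< , pe = a + i , m≤m+n a i , <∸⇒+< b a i i< , pe

lastPartner-stdEdge : ∀ {n s j} → IsEquivᵇ s → j < n ∸ 1 → s j (n ∸ 1) ≡ true → (∀ i → j < i → i < n ∸ 1 → s i (n ∸ 1) ≡ false) → StdEdge n s j (n ∸ 1)
lastPartner-stdEdge {suc n} {s} {j} E j<n sj later = mkE j<n ≤-refl sj (λ k lo hi → ¬≡true⇒≡false λ e → ≡false⇒¬≡true (later k lo hi) (eq-trans E k j n e sj))

-- Walking from x towards z along the block of x, the standard edge that jumps over y is found.
spanning-stdEdge : ∀ {n s} → IsEquivᵇ s → ∀ fuel x y z → z ≤ x + fuel → x < y → y < z → z < n →
  s x z ≡ true → s x y ≡ false →
  Σ ℕ λ a → Σ ℕ λ b → x ≤ a × a < y × y < b × b ≤ z × StdEdge n s a b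
spanning-stdEdge E zero x y z z≤x x<y y<z _ _ _ =
  ⊥-elim (<-irrefl refl (<-≤-trans (<-trans x<y y<z) (subst (z ≤_) (+-identityʳ x) z≤x)))
spanning-stdEdge {n} {s} E (suc fuel) x y z z≤ x<y y<z z<n sxz sxy
  with allᵇ (λ k → not (s k x)) (range (suc x) z) in gap
... | true = x , z , ≤-refl , x<y , y<z , ≤-refl ,
             stdEdge-sound (∧-intro (<⇒<ᵇ′ (<-trans x<y y<z)) (∧-intro (<⇒<ᵇ′ z<n) (∧-intro sxz gap)))
... | false with allᵇ-range-false _ (suc x) z gap
...   | k , x<k , k<z , k∈ with skx ← not-injective {s k x} {true} k∈ | <-cmp k y
...     | tri≈ _ refl _ = ⊥-elim (≡false⇒¬≡true sxy (eq-sym E k x skx))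
...     | tri< k<y _ _ =
  let z≤k+fuel = ≤-trans z≤ (≤-trans (≤-reflexive (+-suc x fuel)) (+-monoˡ-≤ fuel x<k))
      sky = ¬≡true⇒≡false λ e → ≡false⇒¬≡true sxy (eq-trans E x k y (eq-sym E k x skx) e)
      a , b , k≤a , rest = spanning-stdEdge E fuel k y z z≤k+fuel k<y y<z z<n (eq-trans E k x z skx sxz) sky
  in a , b , ≤-trans (<⇒≤ x<k) k≤a , rest
...     | tri> _ _ y<k =
  let k≤x+fuel = ≤-pred (≤-trans k<z (≤-trans z≤ (≤-reflexive (+-suc x fuel))))
      a , b , x≤a , a<y , y<b , b≤k , e = spanning-stdEdge E fuel x y k k≤x+fuel x<y y<k (<-trans k<z z<n) (eq-sym E k x skx) sxy
  in a , b , x≤a , a<y , y<b , ≤-trans b≤k (<⇒≤ k<z) , e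

keepIf : (ℕ → Bool) → Maybe ℕ → ℕ → Maybe ℕ
keepIf P acc j = if P j then just j else acc

foldl-keepIf-view : ∀ (P : ℕ → Bool) h n acc →
  (Σ ℕ λ i → i < n × P (h i) ≡ true × foldl (keepIf P) acc (applyUpTo h n) ≡ just (h i)
      × (∀ i' → i < i' → i' < n → P (h i') ≡ false))
  ⊎ (foldl (keepIf P) acc (applyUpTo h n) ≡ acc × (∀ i → i < n → P (h i) ≡ false))
foldl-keepIf-view P h zero acc = inj₂ (refl , λ i ())
foldl-keepIf-view P h (suc n) acc with foldl-keepIf-view P (λ x → h (suc x)) n (keepIf P acc (h 0))
... | inj₁ (i , i<n , pi , eq , rest) =
  inj₁ (suc i , s≤s i<n , pi , eq , λ { zero () _ ; (suc i') (s≤s i<i') (s≤s i'<n) → rest i' i<i' i'<n })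
... | inj₂ (eq , none) with P (h 0) in e0
...   | true = inj₁ (0 , s≤s z≤n , e0 , eq , λ { zero () _ ; (suc i') _ (s≤s i'<n) → none i' i'<n })
...   | false = inj₂ (eq , λ { zero _ → e0 ; (suc i) (s≤s i<n) → none i i<n })

data LastPartnerView (n : ℕ) (s : BoolRel) : Maybe ℕ → Set where
  no-partner : (∀ i → i < n ∸ 1 → s i (n ∸ 1) ≡ false) → LastPartnerView n s nothing
  partner : ∀ j → j < n ∸ 1 → s j (n ∸ 1) ≡ true → (∀ i → j < i → i < n ∸ 1 → s i (n ∸ 1) ≡ false) → LastPartnerView n s (just j)

lastPartnerView : ∀ n s → LastPartnerView n s (lastPartnerᴿ n s)
lastPartnerView n s with foldl-keepIf-view (λ j → s j (n ∸ 1)) (λ x → x) (n ∸ 1) nothing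
... | inj₁ (i , i<n , pi , eq , rest) = subst (LastPartnerView n s) (sym eq) (partner i i<n pi rest)
... | inj₂ (eq , none) = subst (LastPartnerView n s) (sym eq) (no-partner none)

lastPartner≡just : ∀ n s j → j < n ∸ 1 → s j (n ∸ 1) ≡ true → (∀ i → j < i → i < n ∸ 1 → s i (n ∸ 1) ≡ false) → lastPartnerᴿ n s ≡ just j
lastPartner≡just n s j j<n sj later with lastPartnerᴿ n s | lastPartnerView n s
... | nothing | no-partner none = ⊥-elim (≡false⇒¬≡true (none j j<n) sj)
... | just j' | partner .j' j'<n sj' later' with <-cmp j j'
...   | tri≈ _ eq _ = cong just (sym eq)
...   | tri< j<j' _ _ = ⊥-elim (≡false⇒¬≡true (later j' j<j' j'<n) sj')
...   | tri> _ _ j'<j = ⊥-elim (≡false⇒¬≡true (later' j j'<j j<n) sj)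

lastPartner≡nothing : ∀ n s → (∀ i → i < n ∸ 1 → s i (n ∸ 1) ≡ false) → lastPartnerᴿ n s ≡ nothing
lastPartner≡nothing n s none with lastPartnerᴿ n s | lastPartnerView n s
... | nothing | _ = refl
... | just j' | partner .j' j'<n sj' _ = ⊥-elim (≡false⇒¬≡true (none j' j'<n) sj')

foldl-keepIf-cong : ∀ (P P' : ℕ → Bool) h m acc → (∀ i → i < m → P (h i) ≡ P' (h i)) →
  foldl (keepIf P) acc (applyUpTo h m) ≡ foldl (keepIf P') acc (applyUpTo h m)
foldl-keepIf-cong P P' h zero acc e = refl
foldl-keepIf-cong P P' h (suc m) acc e rewrite e 0 (s≤s z≤n) =
  foldl-keepIf-cong P P' (λ x → h (suc x)) m _ (λ i i<m → e (suc i) (s≤s i<m))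

lastPartner-cong : ∀ n s s' → s ≈⟨ n ⟩ s' → lastPartnerᴿ n s ≡ lastPartnerᴿ n s'
lastPartner-cong zero s s' h = refl
lastPartner-cong (suc n) s s' h = foldl-keepIf-cong _ _ (λ x → x) n nothing (λ i i<n → h i n (m<n⇒m<1+n i<n) ≤-refl)

≈-restrict : ∀ {s s' m n} → m ≤ n → s ≈⟨ n ⟩ s' → s ≈⟨ m ⟩ s'
≈-restrict m≤n h i j i<m j<m = h i j (<-≤-trans i<m m≤n) (<-≤-trans j<m m≤n)

≈-shift : ∀ {s s' n} k m → (∀ i → i < m → k + i < n) → s ≈⟨ n ⟩ s' → shiftRel k s ≈⟨ m ⟩ shiftRel k s'
≈-shift k m b h i j i<m j<m = h (k + i) (k + j) (b i i<m) (b j j<m)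

≈-sym : ∀ {s s' n} → s ≈⟨ n ⟩ s' → s' ≈⟨ n ⟩ s
≈-sym h i j a b = sym (h i j a b)

mutual
  ψᴿ-cong : ∀ f n s s' → s ≈⟨ n ⟩ s' → ψᴿ f n s ≡ ψᴿ f n s'
  ψᴿ-cong zero n s s' h = refl
  ψᴿ-cong (suc f) n s s' h rewrite lastPartner-cong n s s' h = ψᴿ-step-cong f n s s' h (n ≤ᵇ 1) (lastPartnerᴿ n s') (lastPartnerView n s')

  ψᴿ-step-cong : ∀ f n s s' → s ≈⟨ n ⟩ s' → ∀ b m → LastPartnerView n s' m → ψᴿ-step f n s b m ≡ ψᴿ-step f n s' b m
  ψᴿ-step-cong f n s s' h true m _ = refl
  ψᴿ-step-cong f n s s' h false nothing _ = cong onlyL (ψᴿ-cong f (n ∸ 1) s s' (≈-restrict (m∸n≤m n 1) h))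
  ψᴿ-step-cong f n s s' h false (just j) (partner .j j<n _ _) with suc (suc j) ≡ᵇ n
  ... | true = cong onlyR (ψᴿ-cong f (n ∸ 1) s s' (≈-restrict (m∸n≤m n 1) h))
  ... | false = cong₂ both (ψᴿ-cong f (suc (suc j)) s s' (≈-restrict (<∸1⇒2+≤ j<n) h))
                           (ψᴿ-cong f (n ∸ 1 ∸ suc j) _ _ (≈-shift (suc j) _ (shift-bound n j) h))

mutual
  ψᴿ-fuel-irrelevant : ∀ f f' n s → n ≤ f → n ≤ f' → ψᴿ f n s ≡ ψᴿ f' n s
  ψᴿ-fuel-irrelevant zero zero n s a b = refl
  ψᴿ-fuel-irrelevant zero (suc f') zero s a b = refl
  ψᴿ-fuel-irrelevant (suc f) zero zero s a b = refl
  ψᴿ-fuel-irrelevant (suc f) (suc f') n s a b = ψᴿ-step-fuel-irrelevant f f' n s a b (n ≤ᵇ 1) (lastPartnerᴿ n s) (lastPartnerView n s)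

  ψᴿ-step-fuel-irrelevant : ∀ f f' n s → n ≤ suc f → n ≤ suc f' → ∀ b m → LastPartnerView n s m → ψᴿ-step f n s b m ≡ ψᴿ-step f' n s b m
  ψᴿ-step-fuel-irrelevant f f' n s a b true m _ = refl
  ψᴿ-step-fuel-irrelevant f f' n s a b false nothing _ = cong onlyL (ψᴿ-fuel-irrelevant f f' (n ∸ 1) s (∸-monoˡ-≤ 1 a) (∸-monoˡ-≤ 1 b))
  ψᴿ-step-fuel-irrelevant f f' n s a b false (just j) (partner .j j<n _ _) with suc (suc j) ≡ᵇ n in eq
  ... | true = cong onlyR (ψᴿ-fuel-irrelevant f f' (n ∸ 1) s (∸-monoˡ-≤ 1 a) (∸-monoˡ-≤ 1 b))
  ... | false = cong₂ both (ψᴿ-fuel-irrelevant f f' (suc (suc j)) s (lt j<n a eq) (lt j<n b eq))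
                   (ψᴿ-fuel-irrelevant f f' _ _ (≤-trans (m∸n≤m (n ∸ 1) (suc j)) (∸-monoˡ-≤ 1 a)) (≤-trans (m∸n≤m (n ∸ 1) (suc j)) (∸-monoˡ-≤ 1 b)))
    where
    lt : ∀ {j n f} → j < n ∸ 1 → n ≤ suc f → (suc (suc j) ≡ᵇ n) ≡ false → suc (suc j) ≤ f
    lt {j} {n} {f} j<n n≤f e = ≤-pred (≤-trans (≤∧≢⇒< (<∸1⇒2+≤ j<n) (≡ᵇ-false⇒≢ e)) n≤f)

length-init : ∀ w → length (init w) ≡ length w ∸ 1
length-init [] = refl
length-init (x ∷ []) = refl
length-init (x ∷ y ∷ xs) = cong suc (length-init (y ∷ xs))

at-init : ∀ w i → suc i < length w → at (init w) i ≡ at w i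
at-init (x ∷ []) zero (s≤s ())
at-init (x ∷ y ∷ xs) zero _ = refl
at-init (x ∷ y ∷ xs) (suc i) (s≤s h) = at-init (y ∷ xs) i h

at-take : ∀ m w i → i < m → at (take m w) i ≡ at w i
at-take (suc m) [] i _ = refl
at-take (suc m) (x ∷ w) zero _ = refl
at-take (suc m) (x ∷ w) (suc i) (s≤s h) = at-take m w i h

at-drop : ∀ k w i → at (drop k w) i ≡ at w (k + i)
at-drop zero w i = refl
at-drop (suc k) [] i = refl
at-drop (suc k) (x ∷ w) i = at-drop k w i

sameBlock-init : ∀ w → sameBlock (init w) ≈⟨ length w ∸ 1 ⟩ sameBlock w
sameBlock-init w i j a b = cong₂ _≡ᵇ_ (at-init w i (<∸1⇒2+≤ a)) (at-init w j (<∸1⇒2+≤ b))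

sameBlock-take : ∀ m w → sameBlock (take m w) ≈⟨ m ⟩ sameBlock w
sameBlock-take m w i j a b = cong₂ _≡ᵇ_ (at-take m w i a) (at-take m w j b)

sameBlock-drop : ∀ k w i j → sameBlock (drop k w) i j ≡ shiftRel k (sameBlock w) i j
sameBlock-drop k w i j = cong₂ _≡ᵇ_ (at-drop k w i) (at-drop k w j)

record FreshEnv (env : List (ℕ × ℕ)) (nxt : ℕ) : Set where
  constructor mkFreshEnv
  field
    fresh-below : ∀ x v → lookupA env x ≡ just v → v < nxt
    fresh-injective : ∀ x x' v → lookupA env x ≡ just v → lookupA env x' ≡ just v → x ≡ x'
open FreshEnv

standardize'-length : ∀ env nxt xs → length (standardize' env nxt xs) ≡ length xs
standardize'-length env nxt [] = refl
standardize'-length env nxt (x ∷ xs) with lookupA env x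
... | just v = cong suc (standardize'-length env nxt xs)
... | nothing = cong suc (standardize'-length _ _ xs)

FreshEnv-extend : ∀ env x nxt → FreshEnv env nxt → lookupA env x ≡ nothing → FreshEnv ((x , nxt) ∷ env) (suc nxt)
FreshEnv-extend env x nxt I ex = mkFreshEnv lt injective
  where
  lt : ∀ y v → lookupA ((x , nxt) ∷ env) y ≡ just v → v < suc nxt
  lt y v e with x ≡ᵇ y
  ... | true = ≤-reflexive (cong suc (just-injective (sym e)))
  ... | false = m<n⇒m<1+n (fresh-below I y v e)
  injective : ∀ y y' v → lookupA ((x , nxt) ∷ env) y ≡ just v → lookupA ((x , nxt) ∷ env) y' ≡ just v → y ≡ y'
  injective y y' v e e' with x ≡ᵇ y in exy | x ≡ᵇ y' in exy'
  ... | true | true = trans (sym (≡ᵇ⇒≡′ {x} exy)) (≡ᵇ⇒≡′ {x} exy')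
  ... | true | false = ⊥-elim (<-irrefl (sym (just-injective e)) (fresh-below I y' v e'))
  ... | false | true = ⊥-elim (<-irrefl (sym (just-injective e')) (fresh-below I y v e))
  ... | false | false = fresh-injective I y y' v e e'

lookupA-extend : ∀ env x nxt y v → lookupA env x ≡ nothing → lookupA env y ≡ just v → lookupA ((x , nxt) ∷ env) y ≡ just v
lookupA-extend env x nxt y v ex ey with x ≡ᵇ y in exy
... | true with () ← trans (sym ex) (trans (cong (lookupA env) (≡ᵇ⇒≡′ exy)) ey)
... | false = ey

≡ᵇ-cong-⇔ : ∀ {a b c d : ℕ} → (a ≡ b → c ≡ d) → (c ≡ d → a ≡ b) → (a ≡ᵇ b) ≡ (c ≡ᵇ d)
≡ᵇ-cong-⇔ {a} {b} {c} {d} f g = bool-ext (λ e → ≡⇒≡ᵇ′ (f (≡ᵇ⇒≡′ {a} {b} e))) (λ e → ≡⇒≡ᵇ′ (g (≡ᵇ⇒≡′ {c} {d} e)))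

standardize'-label : ∀ env nxt xs → FreshEnv env nxt → ∀ i → i < length xs → ∀ x v → lookupA env x ≡ just v →
  (at (standardize' env nxt xs) i ≡ᵇ v) ≡ (at xs i ≡ᵇ x)
standardize'-label env nxt (y ∷ xs) I i i< x v ex with lookupA env y in ey
standardize'-label env nxt (y ∷ xs) I zero i< x v ex | just u =
  ≡ᵇ-cong-⇔ (λ u≡v → fresh-injective I y x v (subst (λ z → lookupA env y ≡ just z) u≡v ey) ex)
           (λ y≡x → just-injective (trans (sym ey) (trans (cong (lookupA env) y≡x) ex)))
standardize'-label env nxt (y ∷ xs) I (suc i) (s≤s i<) x v ex | just u = standardize'-label env nxt xs I i i< x v ex
standardize'-label env nxt (y ∷ xs) I zero i< x v ex | nothing =
  ≡ᵇ-cong-⇔ (λ e → ⊥-elim (<-irrefl (sym e) (fresh-below I x v ex)))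
           (λ y≡x → case trans (sym ey) (trans (cong (lookupA env) y≡x) ex) of λ ())
standardize'-label env nxt (y ∷ xs) I (suc i) (s≤s i<) x v ex | nothing =
  standardize'-label _ _ xs (FreshEnv-extend env y nxt I ey) i i< x v (lookupA-extend env y nxt x v ey ex)

≡ᵇ-comm : ∀ a b → (a ≡ᵇ b) ≡ (b ≡ᵇ a)
≡ᵇ-comm a b = ≡ᵇ-cong-⇔ {a} {b} {b} {a} sym sym

lookupA-head : ∀ env y nxt → lookupA ((y , nxt) ∷ env) y ≡ just nxt
lookupA-head env y nxt rewrite ≡ᵇ-refl y = refl

standardize'-pattern : ∀ env nxt xs → FreshEnv env nxt → ∀ i k → i < length xs → k < length xs →
  (at (standardize' env nxt xs) i ≡ᵇ at (standardize' env nxt xs) k) ≡ (at xs i ≡ᵇ at xs k)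
standardize'-pattern env nxt (y ∷ xs) I i k i< k< with lookupA env y in ey
standardize'-pattern env nxt (y ∷ xs) I zero zero i< k< | just u = trans (≡ᵇ-refl u) (sym (≡ᵇ-refl y))
standardize'-pattern env nxt (y ∷ xs) I zero (suc k) i< (s≤s k<) | just u =
  trans (≡ᵇ-comm u _) (trans (standardize'-label env nxt xs I k k< y u ey) (≡ᵇ-comm _ y))
standardize'-pattern env nxt (y ∷ xs) I (suc i) zero (s≤s i<) k< | just u = standardize'-label env nxt xs I i i< y u ey
standardize'-pattern env nxt (y ∷ xs) I (suc i) (suc k) (s≤s i<) (s≤s k<) | just u = standardize'-pattern env nxt xs I i k i< k<
standardize'-pattern env nxt (y ∷ xs) I zero zero i< k< | nothing = trans (≡ᵇ-refl nxt) (sym (≡ᵇ-refl y))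
standardize'-pattern env nxt (y ∷ xs) I zero (suc k) i< (s≤s k<) | nothing =
  trans (≡ᵇ-comm nxt _) (trans (standardize'-label _ _ xs (FreshEnv-extend env y nxt I ey) k k< y nxt (lookupA-head env y nxt)) (≡ᵇ-comm _ y))
standardize'-pattern env nxt (y ∷ xs) I (suc i) zero (s≤s i<) k< | nothing =
  standardize'-label _ _ xs (FreshEnv-extend env y nxt I ey) i i< y nxt (lookupA-head env y nxt)
standardize'-pattern env nxt (y ∷ xs) I (suc i) (suc k) (s≤s i<) (s≤s k<) | nothing = standardize'-pattern _ _ xs (FreshEnv-extend env y nxt I ey) i k i< k<

FreshEnv-empty : FreshEnv [] 0
FreshEnv-empty = mkFreshEnv (λ x v ()) (λ x x' v ())

standardize-length : ∀ v → length (standardize v) ≡ length v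
standardize-length v = standardize'-length [] 0 v

sameBlock-standardize : ∀ v → sameBlock (standardize v) ≈⟨ length v ⟩ sameBlock v
sameBlock-standardize v i j a b = standardize'-pattern [] 0 v FreshEnv-empty i j a b

standardize'-RGS : ∀ env nxt xs → FreshEnv env nxt → RGS' nxt (standardize' env nxt xs)
standardize'-RGS env nxt [] I = tt
standardize'-RGS env nxt (y ∷ xs) I with lookupA env y in ey
... | just u = <⇒≤ (fresh-below I y u ey) , subst (λ m → RGS' m (standardize' env nxt xs)) (sym (if-false (≢⇒≡ᵇ-false (<⇒≢ (fresh-below I y u ey))))) (standardize'-RGS env nxt xs I)
... | nothing = ≤-refl , subst (λ m → RGS' m (standardize' ((y , nxt) ∷ env) (suc nxt) xs)) (sym (if-true (≡ᵇ-refl nxt))) (standardize'-RGS _ _ xs (FreshEnv-extend env y nxt I ey))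

standardize-RGS : ∀ v → RGS' 0 (standardize v)
standardize-RGS v = standardize'-RGS [] 0 v FreshEnv-empty

RGS-unique : ∀ m u u' → RGS' m u → RGS' m u' → length u ≡ length u' →
  (∀ i j → i < length u → j < length u → (at u i ≡ᵇ at u j) ≡ (at u' i ≡ᵇ at u' j)) →
  (∀ i c → i < length u → c < m → (at u i ≡ᵇ c) ≡ (at u' i ≡ᵇ c)) → u ≡ u'
RGS-unique m [] [] _ _ _ _ _ = refl
RGS-unique m (x ∷ u) (x' ∷ u') (x≤m , R) (x'≤m , R') len pat old with m≤n⇒m<n∨m≡n x≤m
... | inj₁ x<m = cong₂ _∷_ x≡x' (RGS-unique _ u u' (subst (λ k → RGS' k u) (fls x<m) R) (subst (λ k → RGS' k u') (fls (subst (_< m) x≡x' x<m)) R') (suc-injective len)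
      (λ i j a b → pat (suc i) (suc j) (s≤s a) (s≤s b)) (λ i c a b → old (suc i) c (s≤s a) b))
  where
  x≡x' : x ≡ x'
  x≡x' = sym (≡ᵇ⇒≡′ {x'} {x} (trans (sym (old 0 x (s≤s z≤n) x<m)) (≡ᵇ-refl x)))
  fls : ∀ {y} → y < m → (if y ≡ᵇ m then suc m else m) ≡ m
  fls y<m = if-false (≢⇒≡ᵇ-false (<⇒≢ y<m))
... | inj₂ refl with m≤n⇒m<n∨m≡n x'≤m
...   | inj₁ x'<x = ⊥-elim (<-irrefl (sym (≡ᵇ⇒≡′ {x} {x'} (trans (old 0 x' (s≤s z≤n) x'<x) (≡ᵇ-refl x')))) x'<x)
...   | inj₂ refl = cong (x ∷_) (RGS-unique _ u u' (subst (λ k → RGS' k u) (tru x) R) (subst (λ k → RGS' k u') (tru x) R') (suc-injective len)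
      (λ i j a b → pat (suc i) (suc j) (s≤s a) (s≤s b)) old')
  where
  tru : ∀ y → (if y ≡ᵇ y then suc y else y) ≡ suc y
  tru y = if-true (≡ᵇ-refl y)
  old' : ∀ i c → i < length u → c < suc x → (at u i ≡ᵇ c) ≡ (at u' i ≡ᵇ c)
  old' i c a (s≤s c≤x) with m≤n⇒m<n∨m≡n c≤x
  ... | inj₁ c<x = old (suc i) c (s≤s a) c<x
  ... | inj₂ refl = pat (suc i) 0 (s≤s a) (s≤s z≤n)

lastPartnerView-of : ∀ w {m} → prevOfLast w ≡ m → LastPartnerView (length w) (sameBlock w) m
lastPartnerView-of w refl = lastPartnerView (length w) (sameBlock w)

ψᴿ-cong′ : ∀ f n n' s s' → n ≡ n' → s ≈⟨ n' ⟩ s' → ψᴿ f n s ≡ ψᴿ f n' s'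
ψᴿ-cong′ f n .n s s' refl h = ψᴿ-cong f n s s' h

ψ-go≡ψᴿ : ∀ f w → ψ-go f w ≡ ψᴿ f (length w) (sameBlock w)
ψ-go≡ψᴿ zero w = refl
ψ-go≡ψᴿ (suc f) w with length w ≤ᵇ 1 | prevOfLast w in eq
... | true | _ = refl
... | false | nothing = cong onlyL (trans (ψ-go≡ψᴿ f (init w)) (ψᴿ-cong′ f _ _ _ _ (length-init w) (sameBlock-init w)))
... | false | just j with lastPartnerView-of w eq
...   | partner .j j<n _ _ with suc (suc j) ≡ᵇ length w
...     | true = cong onlyR (trans (ψ-go≡ψᴿ f (init w)) (ψᴿ-cong′ f _ _ _ _ (length-init w) (sameBlock-init w)))
...     | false = cong₂ both
         (trans (ψ-go≡ψᴿ f (take (suc (suc j)) w)) (ψᴿ-cong′ f _ _ _ _ (trans (length-take (suc (suc j)) w) (m≤n⇒m⊓n≡m (<∸1⇒2+≤ j<n))) (sameBlock-take (suc (suc j)) w)))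
         (trans (ψ-go≡ψᴿ f (standardize v)) (ψᴿ-cong′ f _ _ _ _ lenv patv))
  where
  v = drop (suc j) (init w)
  lenv : length (standardize v) ≡ length w ∸ 1 ∸ suc j
  lenv = trans (standardize-length v) (trans (length-drop (suc j) (init w)) (cong (_∸ suc j) (length-init w)))
  patv : sameBlock (standardize v) ≈⟨ length w ∸ 1 ∸ suc j ⟩ shiftRel (suc j) (sameBlock w)
  patv a b a< b< = trans (sameBlock-standardize v a b (subst (a <_) (trans (sym lenv) (standardize-length v)) a<) (subst (b <_) (trans (sym lenv) (standardize-length v)) b<))
             (trans (sameBlock-drop (suc j) (init w) a b)
               (sameBlock-init w (suc j + a) (suc j + b) (<∸⇒+< _ (suc j) a a<) (<∸⇒+< _ (suc j) b b<)))

StdEdge-extend : ∀ {m n s i j} → m ≤ n → StdEdge m s i j → StdEdge n s i j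
StdEdge-extend m≤n (mkE a b c d) = mkE a (<-≤-trans b m≤n) c d

StdEdge-restrict : ∀ {m n s i j} → j < m → StdEdge n s i j → StdEdge m s i j
StdEdge-restrict j<m (mkE a b c d) = mkE a j<m c d

StdEdge-cong : ∀ {n s s' i j} → s ≈⟨ n ⟩ s' → StdEdge n s i j → StdEdge n s' i j
StdEdge-cong h (mkE a b c d) =
  mkE a b (trans (sym (h _ _ (<-trans a b) b)) c)
      (λ k i<k k<j → trans (sym (h k _ (<-trans k<j b) (<-trans a b))) (d k i<k k<j))

StdEdge-unshift : ∀ {m n s} k {i j} → k + m ≤ n → StdEdge m (shiftRel k s) i j → StdEdge n s (k + i) (k + j)
StdEdge-unshift {m} {n} {s} k {i} {j} km≤n (mkE a b c d) =
  mkE (+-monoʳ-< k a) (<-≤-trans (+-monoʳ-< k b) km≤n) c gap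
  where
  gap : ∀ z → k + i < z → z < k + j → s z (k + i) ≡ false
  gap z lo hi = subst (λ w → s w (k + i) ≡ false) (m+[n∸m]≡n k≤z)
      (d (z ∸ k) (+-cancelˡ-< k _ _ (subst (k + i <_) (sym (m+[n∸m]≡n k≤z)) lo))
                 (+-cancelˡ-< k _ _ (subst (_< k + j) (sym (m+[n∸m]≡n k≤z)) hi)))
    where
    k≤z : k ≤ z
    k≤z = ≤-trans (m≤m+n k i) (<⇒≤ lo)

StdEdge-shift : ∀ {m n s} k {i j} → j < m → StdEdge n s (k + i) (k + j) → StdEdge m (shiftRel k s) i j
StdEdge-shift k j<m (mkE a b c d) =
  mkE (+-cancelˡ-< k _ _ a) j<m c (λ z lo hi → d (k + z) (+-monoʳ-< k lo) (+-monoʳ-< k hi))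

Crossing-extend : ∀ {k m n s a b c d} → m ≤ n → Crossing k m s a b c d → Crossing k n s a b c d
Crossing-extend h (mkC e1 e2 x y z w) = mkC (StdEdge-extend h e1) (StdEdge-extend h e2) x y z w

Crossing-restrict : ∀ {k m n s a b c d} → d < m → Crossing k n s a b c d → Crossing k m s a b c d
Crossing-restrict h (mkC e1 e2 x y z w) = mkC (StdEdge-restrict (<-trans z h) e1) (StdEdge-restrict h e2) x y z w

Crossing-cong : ∀ {k n s s' a b c d} → s ≈⟨ n ⟩ s' → Crossing k n s a b c d → Crossing k n s' a b c d
Crossing-cong h (mkC e1 e2 x y z w) = mkC (StdEdge-cong h e1) (StdEdge-cong h e2) x y z w

Crossing-unshift : ∀ {kk m n s} k {a b c d} → k + m ≤ n → Crossing kk m (shiftRel k s) a b c d → Crossing kk n s (k + a) (k + b) (k + c) (k + d)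
Crossing-unshift {kk} k km≤n (mkC e1 e2 x y z w) =
  mkC (StdEdge-unshift k km≤n e1) (StdEdge-unshift k km≤n e2) (+-monoʳ-< k x) (+-monoʳ-< k y) (+-monoʳ-< k z)
      (subst (kk ≤_) (sym ([m+n]∸[m+o]≡n∸o k _ _)) w)

Crossing-shift : ∀ {kk m n s} k {a b c d} → d < m → Crossing kk n s (k + a) (k + b) (k + c) (k + d) → Crossing kk m (shiftRel k s) a b c d
Crossing-shift {kk} k d<m (mkC e1 e2 x y z w) =
  mkC (StdEdge-shift k (<-trans (+-cancelˡ-< k _ _ z) d<m) e1) (StdEdge-shift k d<m e2)
      (+-cancelˡ-< k _ _ x) (+-cancelˡ-< k _ _ y) (+-cancelˡ-< k _ _ z) (subst (kk ≤_) ([m+n]∸[m+o]≡n∸o k _ _) w)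

NonCrossingᴿ : ℕ → ℕ → BoolRel → Set
NonCrossingᴿ k n s = ∀ a b c d → Crossing k n s a b c d → ⊥

NonCrossingᴿ-restrict : ∀ {k m n s} → m ≤ n → NonCrossingᴿ k n s → NonCrossingᴿ k m s
NonCrossingᴿ-restrict h nc a b c d cr = nc a b c d (Crossing-extend h cr)

NonCrossingᴿ-cong : ∀ {k n s s'} → s ≈⟨ n ⟩ s' → NonCrossingᴿ k n s → NonCrossingᴿ k n s'
NonCrossingᴿ-cong h nc a b c d cr = nc a b c d (Crossing-cong (≈-sym h) cr)

NonCrossingᴿ-shift : ∀ {kk m n s} k → k + m ≤ n → NonCrossingᴿ kk n s → NonCrossingᴿ kk m (shiftRel k s)
NonCrossingᴿ-shift k h nc a b c d cr = nc _ _ _ _ (Crossing-unshift k h cr)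

Crossing-bounds : ∀ {k n s a b c d} → Crossing k n s a b c d → a < n × b < n × c < n × d < n
Crossing-bounds (mkC e1 e2 x y z w) = <-trans x (<-trans y (<-trans z (e-bd e2))) , <-trans z (e-bd e2) , <-trans y (<-trans z (e-bd e2)) , e-bd e2

filterᵇ-none : ∀ {A : Set} (p : A → Bool) l → (∀ x → p x ≡ false) → filterᵇ p l ≡ []
filterᵇ-none p [] h = refl
filterᵇ-none p (x ∷ l) h rewrite h x = filterᵇ-none p l h

sum4<≡0⇒ : ∀ n g → sum4< n g ≡ 0 → ∀ a b c d → a < n → b < n → c < n → d < n → g a b c d ≡ 0
sum4<≡0⇒ n g h a b c d a< b< c< d< =
  sum<≡0⇒ n _ (sum<≡0⇒ n _ (sum<≡0⇒ n _ (sum<≡0⇒ n _ h a a<) b b<) c c<) d d<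

ind≡0⇒false : ∀ {b} → ind b ≡ 0 → b ≡ false
ind≡0⇒false {false} _ = refl

NonCrossing⇒ᴿ : ∀ k w → NonCrossing k w → NonCrossingᴿ k (length w) (sameBlock w)
NonCrossing⇒ᴿ k w nc a b c d cr = ≡false⇒¬≡true not-crossing (isCrossing-complete cr)
  where
  n = length w
  no-crossings : count4 n (isCrossingᴿ k n (sameBlock w)) ≡ 0
  no-crossings = trans (sym (length-filterᵇ-quads n _)) (cong length nc)
  not-crossing : isCrossingᴿ k n (sameBlock w) (a , b , c , d) ≡ false
  not-crossing with a< , b< , c< , d< ← Crossing-bounds cr =
    ind≡0⇒false (sum4<≡0⇒ n _ no-crossings a b c d a< b< c< d<)

ᴿ⇒NonCrossing : ∀ k w → NonCrossingᴿ k (length w) (sameBlock w) → NonCrossing k w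
ᴿ⇒NonCrossing k w nc = filterᵇ-none (isCrossingᴿ k (length w) (sameBlock w)) (quads (length w)) λ { (a , b , c , d) → ¬≡true⇒≡false (λ e → nc a b c d (isCrossing-sound e)) }

-- Case 3: gluing two partitions

-- Case 3 with i = j + 2.  The field g-nested is all that 2-distant noncrossing contributes
-- (Glue-fromNonCrossing); it lets π be cut at j + 1 into two partitions and glued back.
record Glue (n : ℕ) (s : BoolRel) (j : ℕ) : Set where
  constructor mkG
  field
    g-equiv : IsEquivᵇ s
    g-bound : suc (suc j) < n
    g-edge : StdEdge n s j (n ∸ 1)
    g-nested : ∀ x y → x < suc j → suc j < y → y < n ∸ 1 → s x y ≡ true → s (suc j) y ≡ true
open Glue public

Glue-unique-bridge : ∀ {n s j x y} → Glue n s j → StdEdge n s x y → x < suc j → suc j < y → x ≡ j × y ≡ n ∸ 1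
Glue-unique-bridge {n} {s} {j} {x} {y} G e x<J J<y with y ≟ n ∸ 1
... | yes refl = stdEdge-unique-left (g-equiv G) e (g-edge G) , refl
... | no y≢ = ⊥-elim (≡false⇒¬≡true (e-gap e (suc j) x<J J<y) (eq-sym E x (suc j) (eq-trans E x y (suc j) (e-same e) (eq-sym E (suc j) y J~y))))
  where
  E = g-equiv G
  J~y = g-nested G x y x<J J<y (<∧≢∸1⇒<∸1 (e-bd e) y≢) (e-same e)

-- If x ~ y straddle j + 1 but j + 1 ≁ x, the standard edge of that block jumping over j + 1
-- crosses (j, n - 1) at distance at least 2.
Glue-fromNonCrossing : ∀ {n s j} → IsEquivᵇ s → NonCrossingᴿ 2 n s → j < n ∸ 1 → s j (n ∸ 1) ≡ true →
  (∀ i → j < i → i < n ∸ 1 → s i (n ∸ 1) ≡ false) → suc (suc j) < n → Glue n s j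
Glue-fromNonCrossing {n} {s} {j} E nc j<n sj later lt = mkG E lt ej H2
  where
  ej = lastPartner-stdEdge E j<n sj later
  n-1<n : n ∸ 1 < n
  n-1<n = e-bd ej
  H2 : ∀ x y → x < suc j → suc j < y → y < n ∸ 1 → s x y ≡ true → s (suc j) y ≡ true
  H2 x y x<J J<y y<n sxy with s x (suc j) in exJ
  ... | true = eq-trans E (suc j) x y (eq-sym E x (suc j) exJ) sxy
  ... | false with spanning-stdEdge E y x (suc j) y (m≤n+m y x) x<J J<y (<-trans y<n n-1<n) sxy exJ
  ...   | a , b , x≤a , a<J , J<b , b≤y , e with a ≟ j
  ...     | yes refl = ⊥-elim (<-irrefl (stdEdge-unique-right E e ej) (≤-<-trans b≤y y<n))
  ...     | no a≢j = ⊥-elim (nc a b j (n ∸ 1) (mkC e ej (≤∧≢⇒< (≤-pred a<J) a≢j) (<-trans (n<1+n j) J<b) (≤-<-trans b≤y y<n) (m+n≤o⇒m≤o∸n 2 J<b)))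

subst4 : ∀ (P : ℕ → ℕ → ℕ → ℕ → Set) {a b c d a' b' c' d'} → a ≡ a' → b ≡ b' → c ≡ c' → d ≡ d' → P a b c d → P a' b' c' d'
subst4 P refl refl refl refl p = p

Crossing-shift′ : ∀ {kk m n s} J {a b c d} → J ≤ a → J ≤ b → J ≤ c → J ≤ d → d ∸ J < m →
  Crossing kk n s a b c d → Crossing kk m (shiftRel J s) (a ∸ J) (b ∸ J) (c ∸ J) (d ∸ J)
Crossing-shift′ {kk} {m} {n} {s} J {a} {b} {c} {d} ja jb jc jd dm cr =
  Crossing-shift J dm (subst4 (Crossing kk n s) (sym (m+[n∸m]≡n ja)) (sym (m+[n∸m]≡n jb)) (sym (m+[n∸m]≡n jc)) (sym (m+[n∸m]≡n jd)) cr)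

Crossing-unshift′ : ∀ {kk m n s} J {a b c d} → J + m ≤ n → J ≤ a → J ≤ b → J ≤ c → J ≤ d →
  Crossing kk m (shiftRel J s) (a ∸ J) (b ∸ J) (c ∸ J) (d ∸ J) → Crossing kk n s a b c d
Crossing-unshift′ {kk} {m} {n} {s} J {a} {b} {c} {d} h ja jb jc jd cr =
  subst4 (Crossing kk n s) (m+[n∸m]≡n ja) (m+[n∸m]≡n jb) (m+[n∸m]≡n jc) (m+[n∸m]≡n jd) (Crossing-unshift J h cr)

data CrossingSplit (k n : ℕ) (s : BoolRel) (j a b c d : ℕ) : Set where
  inside-left : Crossing k (suc (suc j)) s a b c d → CrossingSplit k n s j a b c d
  inside-right : suc j ≤ a → Crossing k (n ∸ 1 ∸ suc j) (shiftRel (suc j) s) (a ∸ suc j) (b ∸ suc j) (c ∸ suc j) (d ∸ suc j) → CrossingSplit k n s j a b c d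
  straddling : c ≡ j → d ≡ n ∸ 1 → b ≡ suc j → a < j → CrossingSplit k n s j a b c d

crossingSplit-high : ∀ {k n s j a b c d} → Glue n s j → Crossing k n s a b c d → suc (suc j) ≤ d → CrossingSplit k n s j a b c d
crossingSplit-high {k} {n} {s} {j} {a} {b} {c} {d} G cr jd with c <? suc j
... | yes c<J with Glue-unique-bridge G (c-e2 cr) c<J jd
...   | refl , refl with <-cmp b (suc j)
...     | tri< b<J _ _ = ⊥-elim (<-irrefl refl (<-≤-trans (c-cb cr) (≤-pred b<J)))
...     | tri≈ _ b≡ _ = straddling refl refl b≡ (c-ac cr)
...     | tri> _ _ J<b = ⊥-elim (<-irrefl (proj₂ (Glue-unique-bridge G (c-e1 cr) (<-trans (c-ac cr) c<J) J<b)) (c-bd cr))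
crossingSplit-high {k} {n} {s} {j} {a} {b} {c} {d} G cr jd | no c≮J = hi (≮⇒≥ c≮J)
  where
  hi : suc j ≤ c → CrossingSplit k n s j a b c d
  hi jc with a <? suc j
  ... | yes a<J = ⊥-elim (<-irrefl (proj₂ (Glue-unique-bridge G (c-e1 cr) a<J (≤-<-trans jc (c-cb cr)))) (<-≤-trans (c-bd cr) (<⇒≤∸1 (e-bd (c-e2 cr)))))
  ... | no a≮J with d ≟ n ∸ 1
  ...   | yes refl = ⊥-elim (<-irrefl (sym (stdEdge-unique-left (g-equiv G) (c-e2 cr) (g-edge G))) jc)
  ...   | no d≢ = inside-right ja (Crossing-shift′ (suc j) ja jb jc jd' (∸-monoˡ-< d< jd') cr)
    where
    ja = ≮⇒≥ a≮J
    jb = ≤-trans jc (<⇒≤ (c-cb cr))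
    jd' = ≤-trans jb (<⇒≤ (c-bd cr))
    d< = <∧≢∸1⇒<∸1 (e-bd (c-e2 cr)) d≢

crossingSplit : ∀ {k n s j a b c d} → Glue n s j → Crossing k n s a b c d → CrossingSplit k n s j a b c d
crossingSplit {k} {n} {s} {j} {a} {b} {c} {d} G cr with d <? suc (suc j)
... | yes d< = inside-left (Crossing-restrict d< cr)
... | no d≮ = crossingSplit-high G cr (≮⇒≥ d≮)

crossingCount : ℕ → ℕ → BoolRel → ℕ
crossingCount k n s = count4 n (isCrossingᴿ k n s)

isCrossing-sound′ : ∀ k n s a b c d → isCrossingᴿ k n s (a , b , c , d) ≡ true → Crossing k n s a b c d
isCrossing-sound′ k n s a b c d = isCrossing-sound {k} {n} {s} {a} {b} {c} {d}

below-all : ∀ {k a b c d} → (k ≤ a ⊎ k ≤ b ⊎ k ≤ c ⊎ k ≤ d) → a < k → b < k → c < k → d < k → ⊥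
below-all (inj₁ x) a< _ _ _ = <-irrefl refl (<-≤-trans a< x)
below-all (inj₂ (inj₁ x)) _ b< _ _ = <-irrefl refl (<-≤-trans b< x)
below-all (inj₂ (inj₂ (inj₁ x))) _ _ c< _ = <-irrefl refl (<-≤-trans c< x)
below-all (inj₂ (inj₂ (inj₂ x))) _ _ _ d< = <-irrefl refl (<-≤-trans d< x)

above-all : ∀ {k a b c d} → k ≤ a → a < c → c < b → b < d → (a < k ⊎ b < k ⊎ c < k ⊎ d < k) → ⊥
above-all ka ac cb bd (inj₁ x) = <-irrefl refl (<-≤-trans x ka)
above-all ka ac cb bd (inj₂ (inj₁ x)) = <-irrefl refl (<-≤-trans x (≤-trans ka (<⇒≤ (<-trans ac cb))))
above-all ka ac cb bd (inj₂ (inj₂ (inj₁ x))) = <-irrefl refl (<-≤-trans x (≤-trans ka (<⇒≤ ac)))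
above-all ka ac cb bd (inj₂ (inj₂ (inj₂ x))) = <-irrefl refl (<-≤-trans x (≤-trans ka (<⇒≤ (<-trans ac (<-trans cb bd)))))

Crossing-outside : ∀ {k n s a b c d} → Crossing k n s a b c d → (n ≤ a ⊎ n ≤ b ⊎ n ≤ c ⊎ n ≤ d) → ⊥
Crossing-outside cr out = let bd = Crossing-bounds cr in below-all out (proj₁ bd) (proj₁ (proj₂ bd)) (proj₁ (proj₂ (proj₂ bd))) (proj₂ (proj₂ (proj₂ bd)))

module GlueCrossings {n s j} (G : Glue n s j) where
  m = n ∸ 1 ∸ suc j
  U = shiftRel (suc j) s

  J<n-1 : suc j < n ∸ 1
  J<n-1 = ∸-monoˡ-< (g-bound G) (s≤s z≤n)

  Jm≤n : suc j + m ≤ n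
  Jm≤n = ≤-trans (≤-reflexive (m+[n∸m]≡n (<⇒≤ J<n-1))) (m∸n≤m n 1)

  inLeft inRight straddles : ℕ × ℕ × ℕ × ℕ → Bool
  inLeft q = isCrossingᴿ 1 (suc (suc j)) s q
  inRight (a , b , c , d) = (suc j ≤ᵇ a) ∧ isCrossingᴿ 1 m U (a ∸ suc j , b ∸ suc j , c ∸ suc j , d ∸ suc j)
  straddles (a , b , c , d) = isCrossingᴿ 1 n s (a , b , c , d) ∧ (c ≡ᵇ j)

  inRight-crossing : ∀ a b c d → inRight (a , b , c , d) ≡ true → suc j ≤ a × Crossing 1 n s a b c d
  inRight-crossing a b c d e =
    let ja = ≤ᵇ⇒≤′ (∧-elimˡ e)
        cr = isCrossing-sound′ 1 m U (a ∸ suc j) (b ∸ suc j) (c ∸ suc j) (d ∸ suc j) (∧-elimʳ {suc j ≤ᵇ a} e)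
        jc = <∸⇒≤ (suc j) (c-ac cr)
        jb = <∸⇒≤ (suc j) (c-cb cr)
        jd = <∸⇒≤ (suc j) (c-bd cr)
    in ja , Crossing-unshift′ (suc j) Jm≤n ja jb jc jd cr

  inLeft⇒crossing : ∀ a b c d → inLeft (a , b , c , d) ≡ true → isCrossingᴿ 1 n s (a , b , c , d) ≡ true
  inLeft⇒crossing a b c d e = isCrossing-complete (Crossing-extend (<⇒≤ (g-bound G)) (isCrossing-sound′ 1 (suc (suc j)) s a b c d e))

  inRight⇒crossing : ∀ a b c d → inRight (a , b , c , d) ≡ true → isCrossingᴿ 1 n s (a , b , c , d) ≡ true
  inRight⇒crossing a b c d e = isCrossing-complete (proj₂ (inRight-crossing a b c d e))

  inLeft-start : ∀ {a b c d} → Crossing 1 (suc (suc j)) s a b c d → a < suc j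
  inLeft-start cr = ≤-trans (<-trans (<-trans (c-ac cr) (c-cb cr)) (c-bd cr)) (≤-pred (e-bd (c-e2 cr)))

  inLeft-second-start : ∀ {a b c d} → Crossing 1 (suc (suc j)) s a b c d → c < j
  inLeft-second-start cr = ≤-pred (≤-trans (≤-trans (s≤s (c-cb cr)) (c-bd cr)) (≤-pred (e-bd (c-e2 cr))))

  ind3-1 : ∀ {x y z} → x ≡ true → y ≡ false → z ≡ false → 1 ≡ ind x + ind y + ind z
  ind3-1 refl refl refl = refl
  ind3-2 : ∀ {x y z} → x ≡ false → y ≡ true → z ≡ false → 1 ≡ ind x + ind y + ind z
  ind3-2 refl refl refl = refl
  ind3-3 : ∀ {x y z} → x ≡ false → y ≡ false → z ≡ true → 1 ≡ ind x + ind y + ind z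
  ind3-3 refl refl refl = refl
  ind3-0 : ∀ {x y z} → x ≡ false → y ≡ false → z ≡ false → 0 ≡ ind x + ind y + ind z
  ind3-0 refl refl refl = refl

  crossing-ind-split : ∀ a b c d → ind (isCrossingᴿ 1 n s (a , b , c , d)) ≡ ind (inLeft (a , b , c , d)) + ind (inRight (a , b , c , d)) + ind (straddles (a , b , c , d))
  crossing-ind-split a b c d with isCrossingᴿ 1 n s (a , b , c , d) in eC
  ... | false = ind3-0 (¬≡true⇒≡false (λ e → ≡false⇒¬≡true eC (inLeft⇒crossing a b c d e)))
                       (¬≡true⇒≡false (λ e → ≡false⇒¬≡true eC (inRight⇒crossing a b c d e)))
                       refl
  ... | true with crossingSplit G (isCrossing-sound′ 1 n s a b c d eC)
  ...   | inside-left crL = ind3-1 (isCrossing-complete crL)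
          (¬≡true⇒≡false (λ e → <-irrefl refl (≤-<-trans (proj₁ (inRight-crossing a b c d e)) (inLeft-start crL))))
          (¬≡true⇒≡false (λ e → <-irrefl (≡ᵇ⇒≡′ e) (inLeft-second-start crL)))
  ...   | inside-right ja crU = ind3-2
          (¬≡true⇒≡false (λ e → <-irrefl refl (≤-<-trans ja (inLeft-start (isCrossing-sound′ 1 (suc (suc j)) s a b c d e)))))
          (∧-intro (≤⇒≤ᵇ′ ja) (isCrossing-complete crU))
          (¬≡true⇒≡false (λ e → <-irrefl (sym (≡ᵇ⇒≡′ e)) (≤-trans ja (<⇒≤ (c-ac (isCrossing-sound′ 1 n s a b c d eC))))))
  ...   | straddling refl refl refl a<j = ind3-3
          (¬≡true⇒≡false (λ e → <-irrefl refl (≤-<-trans J<n-1 (e-bd (c-e2 (isCrossing-sound′ 1 (suc (suc j)) s a (suc j) j (n ∸ 1) e))))))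
          (¬≡true⇒≡false (λ e → <-irrefl refl (≤-<-trans (proj₁ (inRight-crossing a (suc j) j (n ∸ 1) e)) (<-trans a<j (n<1+n j)))))
          (≡ᵇ-refl j)

  inRight-shift : ∀ a b c d → inRight (suc j + a , suc j + b , suc j + c , suc j + d) ≡ isCrossingᴿ 1 m U (a , b , c , d)
  inRight-shift a b c d = cong₂ _∧_ (≤⇒≤ᵇ′ (m≤m+n (suc j) a))
    (cong (isCrossingᴿ 1 m U) (cong₂ _,_ (m+n∸m≡n (suc j) a) (cong₂ _,_ (m+n∸m≡n (suc j) b) (cong₂ _,_ (m+n∸m≡n (suc j) c) (m+n∸m≡n (suc j) d)))))

  count-inLeft : count4 n inLeft ≡ crossingCount 1 (suc (suc j)) s
  count-inLeft = sum4<-truncate (suc (suc j)) n _ (<⇒≤ (g-bound G)) λ a b c d _ _ _ _ out → ind-false λ e →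
         Crossing-outside (isCrossing-sound′ 1 (suc (suc j)) s a b c d e) out

  count-inRight : count4 n inRight ≡ crossingCount 1 m U
  count-inRight = trans (cong (λ k → sum4< k g) (sym n≡))
       (trans (sum4<-shift (suc j) r g van)
       (trans (sum4<-cong r _ _ (λ a b c d _ _ _ _ → cong ind (inRight-shift a b c d)))
       (sum4<-truncate m r _ m≤r (λ a b c d _ _ _ _ out → ind-false λ e → Crossing-outside (isCrossing-sound′ 1 m U a b c d e) out))))
    where
    g = λ a b c d → ind (inRight (a , b , c , d))
    r = n ∸ suc j
    n≡ : suc j + r ≡ n
    n≡ = m+[n∸m]≡n (<⇒≤ (<-trans (n<1+n (suc j)) (g-bound G)))
    m≤r : m ≤ r
    m≤r = ∸-monoˡ-≤ (suc j) (m∸n≤m n 1)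
    van : ∀ a b c d → a < suc j + r → b < suc j + r → c < suc j + r → d < suc j + r → (a < suc j ⊎ b < suc j ⊎ c < suc j ⊎ d < suc j) → g a b c d ≡ 0
    van a b c d _ _ _ _ low = ind-false λ e → let p = inRight-crossing a b c d e ; cr = proj₂ p in above-all (proj₁ p) (c-ac cr) (c-cb cr) (c-bd cr) low

  crossingCount-glue : crossingCount 1 n s ≡ crossingCount 1 (suc (suc j)) s + crossingCount 1 m U + count4 n straddles
  crossingCount-glue = trans (sum4<-cong n _ _ (λ a b c d _ _ _ _ → crossing-ind-split a b c d))
         (trans (sum4<-+ n _ _) (cong₂ _+_ (trans (sum4<-+ n _ _) (cong₂ _+_ count-inLeft count-inRight)) refl))

  straddles-shape : ∀ a b c d → straddles (a , b , c , d) ≡ true → b ≡ suc j × c ≡ j × d ≡ n ∸ 1 × a < j × StdEdge n s a (suc j)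
  straddles-shape a b c d e with crossingSplit G (isCrossing-sound′ 1 n s a b c d (∧-elimˡ e)) | ≡ᵇ⇒≡′ {c} {j} (∧-elimʳ {isCrossingᴿ 1 n s (a , b , c , d)} e)
  ... | inside-left crL | refl = ⊥-elim (<-irrefl refl (inLeft-second-start crL))
  ... | inside-right ja crU | refl = ⊥-elim (<-irrefl refl (≤-trans ja (<⇒≤ (c-ac (isCrossing-sound′ 1 n s a b c d (∧-elimˡ e))))))
  ... | straddling c≡ d≡ refl a<j | refl = refl , c≡ , d≡ , a<j , c-e1 (isCrossing-sound′ 1 n s a (suc j) c d (∧-elimˡ e))

  count-straddles-none : (∀ i → i < suc j → s i (suc j) ≡ false) → count4 n straddles ≡ 0
  count-straddles-none none = sum4<-zero n _ λ a b c d _ _ _ _ → ind-false λ e →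
    let p = straddles-shape a b c d e
        ed = proj₂ (proj₂ (proj₂ (proj₂ p)))
    in ≡false⇒¬≡true (none a (e-lt ed)) (e-same ed)

  count-straddles-one : ∀ j' → j' < j → StdEdge n s j' (suc j) → count4 n straddles ≡ 1
  count-straddles-one j' j'<j ed' =
    trans (sum4<-point n _ j' (suc j) j (n ∸ 1) (<-trans (e-lt ed') (e-bd ed')) (e-bd ed') (<-trans (n<1+n j) (e-bd ed')) (e-bd (g-edge G)) van)
      (cong ind (∧-intro (isCrossing-complete (mkC ed' (g-edge G) j'<j (n<1+n j) J<n-1 (m+n≤o⇒m≤o∸n 1 {j} ≤-refl))) (≡ᵇ-refl j)))
    where
    van : ∀ a b c d → a < n → b < n → c < n → d < n → (a ≢ j' ⊎ b ≢ suc j ⊎ c ≢ j ⊎ d ≢ n ∸ 1) → ind (straddles (a , b , c , d)) ≡ 0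
    van a b c d _ _ _ _ ne = ind-false λ e → go ne (straddles-shape a b c d e)
      where
      go : (a ≢ j' ⊎ b ≢ suc j ⊎ c ≢ j ⊎ d ≢ n ∸ 1) → b ≡ suc j × c ≡ j × d ≡ n ∸ 1 × a < j × StdEdge n s a (suc j) → ⊥
      go (inj₁ x) (_ , _ , _ , _ , ea) = x (stdEdge-unique-left (g-equiv G) ea ed')
      go (inj₂ (inj₁ x)) (y , _ , _ , _ , _) = x y
      go (inj₂ (inj₂ (inj₁ x))) (_ , y , _ , _ , _) = x y
      go (inj₂ (inj₂ (inj₂ x))) (_ , _ , y , _ , _) = x y

  NonCrossing-glue : NonCrossingᴿ 2 (suc (suc j)) s → NonCrossingᴿ 2 m U → NonCrossingᴿ 2 n s
  NonCrossing-glue ncL ncU a b c d cr with crossingSplit G cr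
  ... | inside-left x = ncL _ _ _ _ x
  ... | inside-right _ x = ncU _ _ _ _ x
  ... | straddling refl refl refl _ = <-irrefl refl (<-≤-trans (s≤s (s≤s z≤n)) (subst (2 ≤_) (m+n∸n≡m 1 j) (c-k cr)))

opensBlock : BoolRel → ℕ → Bool
opensBlock s i = allᵇ (λ k → not (s k i)) (upTo i)

blockCount : ℕ → BoolRel → ℕ
blockCount n s = sum< n (λ i → ind (opensBlock s i))

opensBlock-false : ∀ s j p → j < p → s j p ≡ true → opensBlock s p ≡ false
opensBlock-false s j p j<p e = ¬≡true⇒≡false λ a → ≡false⇒¬≡true (not-elim (allᵇ-upTo⁻ _ p a j j<p)) e

module GlueBlocks {n s j} (G : Glue n s j) where
  open GlueCrossings G

  opensBlock-right : ∀ i → suc (suc j) + i < n ∸ 1 → opensBlock s (suc (suc j) + i) ≡ opensBlock U (suc i)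
  opensBlock-right i lt = bool-ext to from
    where
    y≡ : suc (suc j) + i ≡ suc j + suc i
    y≡ = cong suc (sym (+-suc j i))
    to : opensBlock s (suc (suc j) + i) ≡ true → opensBlock U (suc i) ≡ true
    to e = allᵇ-upTo⁺ _ (suc i) λ k k< → not-intro (subst (λ y → s (suc j + k) y ≡ false) y≡
             (not-elim (allᵇ-upTo⁻ (λ k → not (s k (suc (suc j) + i))) (suc (suc j) + i) e (suc j + k) (subst (suc j + k <_) (sym y≡) (+-monoʳ-< (suc j) k<)))))
    from : opensBlock U (suc i) ≡ true → opensBlock s (suc (suc j) + i) ≡ true
    from e = allᵇ-upTo⁺ _ _ λ k k< → not-intro (part k k<)
      where
      h : ∀ k → k < suc i → s (suc j + k) (suc j + suc i) ≡ false
      h k k< = not-elim (allᵇ-upTo⁻ _ (suc i) e k k<)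
      part : ∀ k → k < suc (suc j) + i → s k (suc (suc j) + i) ≡ false
      part k k< with suc j ≤? k
      ... | yes jk = subst (λ y → s y (suc (suc j) + i) ≡ false) (m+[n∸m]≡n jk)
                     (subst (λ y → s (suc j + (k ∸ suc j)) y ≡ false) (sym y≡)
                       (h (k ∸ suc j) (+-cancelˡ-< (suc j) _ _ (subst₂ _<_ (sym (m+[n∸m]≡n jk)) y≡ k<))))
      ... | no nk = ¬≡true⇒≡false λ e' → ≡false⇒¬≡true (subst (λ y → s y (suc j + suc i) ≡ false) (+-identityʳ (suc j)) (h 0 (s≤s z≤n)))
                       (subst (λ y → s (suc j) y ≡ true) y≡ (g-nested G k _ (≰⇒> nk) (s≤s (m≤m+n (suc j) i)) lt e'))

  blockCount-glue′ : ∀ m'' → m ≡ suc m'' → blockCount n s + 1 ≡ blockCount (suc (suc j)) s + blockCount m U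
  blockCount-glue′ m'' meq = begin
      blockCount n s + 1
    ≡⟨ cong (λ k → sum< k f + 1) nEq ⟩
      sum< (suc (suc j) + suc m'') f + 1
    ≡⟨ cong (_+ 1) (sum<-split (suc (suc j)) (suc m'') f) ⟩
      sum< (suc (suc j)) f + sum< (suc m'') (λ i → f (suc (suc j) + i)) + 1
    ≡⟨ cong (λ x → sum< (suc (suc j)) f + x + 1) (sum<-last m'' (λ i → f (suc (suc j) + i))) ⟩
      sum< (suc (suc j)) f + (sum< m'' (λ i → f (suc (suc j) + i)) + f (suc (suc j) + m'')) + 1
    ≡⟨ cong (λ x → sum< (suc (suc j)) f + (sum< m'' (λ i → f (suc (suc j) + i)) + x) + 1) lastZero ⟩
      sum< (suc (suc j)) f + (sum< m'' (λ i → f (suc (suc j) + i)) + 0) + 1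
    ≡⟨ cong (λ x → sum< (suc (suc j)) f + (x + 0) + 1) (sum<-cong m'' _ _ λ i i< → cong ind (opensBlock-right i (idx< i i<))) ⟩
      sum< (suc (suc j)) f + (sum< m'' (λ i → ind (opensBlock U (suc i))) + 0) + 1
    ≡⟨ arith (sum< (suc (suc j)) f) (sum< m'' (λ i → ind (opensBlock U (suc i)))) ⟩
      blockCount (suc (suc j)) s + blockCount (suc m'') U
    ≡⟨ cong (λ k → blockCount (suc (suc j)) s + blockCount k U) (sym meq) ⟩
      blockCount (suc (suc j)) s + blockCount m U
    ∎
    where
    open ≡-Reasoning
    f = λ i → ind (opensBlock s i)
    arith : ∀ a b → a + (b + 0) + 1 ≡ a + suc b
    arith a b = trans (+-assoc a (b + 0) 1) (cong (a +_) (trans (cong (_+ 1) (+-identityʳ b)) (+-comm b 1)))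
    j2≤n : suc (suc j) ≤ n
    j2≤n = <⇒≤ (g-bound G)
    nEq : n ≡ suc (suc j) + suc m''
    nEq = trans (sym (m+[n∸m]≡n j2≤n)) (cong (suc (suc j) +_) (trans (sym (∸-+-assoc n 1 (suc j))) meq))
    lastIdx : suc (suc j) + m'' ≡ n ∸ 1
    lastIdx = trans (sym (cong (_∸ 1) (+-suc (suc (suc j)) m''))) (cong (_∸ 1) (sym nEq))
    lastZero : f (suc (suc j) + m'') ≡ 0
    lastZero = cong ind (trans (cong (opensBlock s) lastIdx) (opensBlock-false s j (n ∸ 1) (e-lt (g-edge G)) (e-same (g-edge G))))
    idx< : ∀ i → i < m'' → suc (suc j) + i < n ∸ 1
    idx< i i< = subst (suc (suc j) + i <_) lastIdx (+-monoʳ-< (suc (suc j)) i<)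

  m-pos : 0 < m
  m-pos = subst (_< m) (n∸n≡0 (suc j)) (∸-monoˡ-< J<n-1 (≤-refl {suc j}))

  pos-suc : ∀ x → 0 < x → x ≡ suc (x ∸ 1)
  pos-suc (suc x) _ = refl

  blockCount-glue : blockCount n s + 1 ≡ blockCount (suc (suc j)) s + blockCount m U
  blockCount-glue = blockCount-glue′ (m ∸ 1) (pos-suc m m-pos)

outside-last : ∀ {k a b c d} → a < c → c < b → b < d → (k ≤ a ⊎ k ≤ b ⊎ k ≤ c ⊎ k ≤ d) → k ≤ d
outside-last ac cb bd (inj₁ x) = ≤-trans x (<⇒≤ (<-trans ac (<-trans cb bd)))
outside-last ac cb bd (inj₂ (inj₁ x)) = ≤-trans x (<⇒≤ bd)
outside-last ac cb bd (inj₂ (inj₂ (inj₁ x))) = ≤-trans x (<⇒≤ (<-trans cb bd))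
outside-last ac cb bd (inj₂ (inj₂ (inj₂ x))) = x

crossingCount-dropLast : ∀ n' s → (∀ a b c → Crossing 1 (suc n') s a b c n' → ⊥) → crossingCount 1 (suc n') s ≡ crossingCount 1 n' s
crossingCount-dropLast n' s H =
  trans (sum4<-truncate n' (suc n') _ (n≤1+n n') (λ a b c d _ _ _ _ out → ind-false λ e →
           let cr = isCrossing-sound′ 1 (suc n') s a b c d e
               d≡ = ≤-antisym (≤-pred (e-bd (c-e2 cr))) (outside-last (c-ac cr) (c-cb cr) (c-bd cr) out)
           in H a b c (subst (Crossing 1 (suc n') s a b c) d≡ cr)))
  (sum4<-cong n' _ _ λ a b c d _ _ _ d< → cong ind (bool-ext
      (λ e → isCrossing-complete (Crossing-restrict d< (isCrossing-sound′ 1 (suc n') s a b c d e)))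
      (λ e → isCrossing-complete (Crossing-extend (n≤1+n n') (isCrossing-sound′ 1 n' s a b c d e)))))

blockCount-last : ∀ n' s → blockCount (suc n') s ≡ blockCount n' s + ind (opensBlock s n')
blockCount-last n' s = sum<-last n' (λ i → ind (opensBlock s i))

opensBlock-true : ∀ s p → (∀ i → i < p → s i p ≡ false) → opensBlock s p ≡ true
opensBlock-true s p h = allᵇ-upTo⁺ _ p λ i i< → not-intro (h i i<)

-- (j, j + 1) is not an edge, so ψ(π ∩ [j + 2]) is not onlyR; it is fulfilled iff j + 1 has a
-- predecessor j' < j in its block, and then (j', j + 1), (j, n - 1) is the only straddling crossing.
module GlueLeftTree {n s j} (G : Glue n s j) where
  open GlueCrossings G

  glue-left-tree : ∀ f'' → HasLeftChild (ψᴿ (suc f'') (suc (suc j)) s) × (count4 n straddles ≡ isFulfilled (ψᴿ (suc f'') (suc (suc j)) s))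
  glue-left-tree f'' with lastPartnerᴿ (suc (suc j)) s | lastPartnerView (suc (suc j)) s
  ... | nothing | no-partner none = tt , count-straddles-none none
  ... | just j' | partner .j' j'<J sj' later' with suc (suc j') ≡ᵇ suc (suc j) in e
  ...   | true = ⊥-elim (≡false⇒¬≡true (e-gap (g-edge G) (suc j) (n<1+n j) J<n-1) (eq-sym (g-equiv G) j (suc j) (subst (λ x → s x (suc j) ≡ true) j'≡j sj')))
    where
    j'≡j : j' ≡ j
    j'≡j = suc-injective (suc-injective (≡ᵇ⇒≡′ e))
  ...   | false = tt , count-straddles-one j' (≤∧≢⇒< (≤-pred j'<J) (λ eq → ≡ᵇ-false⇒≢ e (cong suc (cong suc eq))))
                        (StdEdge-extend (<⇒≤ (g-bound G)) (lastPartner-stdEdge (g-equiv G) j'<J sj' later'))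

Glue-left-fuel : ∀ {f n s j} → n ≤ suc f → Glue n s j → suc (suc j) ≤ f
Glue-left-fuel le G = ≤-pred (≤-trans (g-bound G) le)

Glue-left-noncrossing : ∀ {n s j} → Glue n s j → NonCrossingᴿ 2 n s → NonCrossingᴿ 2 (suc (suc j)) s
Glue-left-noncrossing G = NonCrossingᴿ-restrict (<⇒≤ (g-bound G))

balance-onlyL : ∀ F' f l o → F' + f ≡ l + o → (F' + 1) + f ≡ l + suc o
balance-onlyL F' f l o h = trans (lemma F' f) (trans (cong suc h) (sym (+-suc l o)))
  where
  lemma : ∀ a b → (a + 1) + b ≡ suc (a + b)
  lemma = solve-∀

balance-onlyR : ∀ F' f l o → F' + f ≡ l + o → (F' + 0) + f ≡ l + o
balance-onlyR F' f l o h = trans (cong (_+ f) (+-identityʳ F')) h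

balance-both : ∀ Fn FL FU fL fU lL lU oL oU → Fn + 1 ≡ FL + FU → FL + fL ≡ lL + oL → FU + fU ≡ lU + oU →
  Fn + suc (fL + fU) ≡ (lL + lU) + (oL + oU)
balance-both Fn FL FU fL fU lL lU oL oU h1 h2 h3 = begin
  Fn + suc (fL + fU)     ≡⟨ +suc≡+1+ Fn (fL + fU) ⟩
  (Fn + 1) + (fL + fU)   ≡⟨ cong (_+ (fL + fU)) h1 ⟩
  (FL + FU) + (fL + fU)  ≡⟨ interchange FL FU fL fU ⟩
  (FL + fL) + (FU + fU)  ≡⟨ cong₂ _+_ h2 h3 ⟩
  (lL + oL) + (lU + oU)  ≡⟨ interchange lL oL lU oU ⟩
  (lL + lU) + (oL + oU)  ∎
  where
  open ≡-Reasoning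
  +suc≡+1+ : ∀ a b → a + suc b ≡ (a + 1) + b
  +suc≡+1+ = solve-∀

crossings-both : ∀ c cL cU q xL xU iF → c ≡ cL + cU + q → cL ≡ xL → cU ≡ xU → q ≡ iF → c ≡ iF + xL + xU
crossings-both c cL cU q xL xU iF h refl refl refl = trans h (lemma cL cU q)
  where
  lemma : ∀ a b c → a + b + c ≡ c + a + b
  lemma = solve-∀

-- Statistics of ψ

-- The block identity (i) is kept free of subtraction.
record ψProps (n : ℕ) (s : BoolRel) (T : Tree) : Set where
  constructor mkψProps
  field
    ψ-unfulfilled : unfulfilled T ≡ n
    ψ-leftCond : LeftCond T
    ψ-blocks : blockCount n s + fulfilled T ≡ leaves T + onlyLeftCount T
    ψ-crossings : crossingCount 1 n s ≡ leftFulfilledPairs T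
open ψProps public

ψPropsUpTo : ℕ → Set
ψPropsUpTo f = ∀ n s → n ≤ f → 1 ≤ n → IsEquivᵇ s → NonCrossingᴿ 2 n s → ψProps n s (ψᴿ f n s)

ψProps-case3 : ∀ f'' → ψPropsUpTo (suc f'') → ∀ n' s j → suc (suc n') ≤ suc (suc f'') → NonCrossingᴿ 2 (suc (suc n')) s → (G : Glue (suc (suc n')) s j) →
  ψProps (suc (suc n')) s (both (ψᴿ (suc f'') (suc (suc j)) s) (ψᴿ (suc f'') (suc n' ∸ suc j) (shiftRel (suc j) s)))
ψProps-case3 f'' ih n' s j le nc G =
  mkψProps (trans (cong₂ _+_ (ψ-unfulfilled IHL) (ψ-unfulfilled IHU)) (cong suc (m+[n∸m]≡n (<⇒≤ J<n-1))))
      (proj₁ (glue-left-tree f'') , ψ-leftCond IHL , ψ-leftCond IHU)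
      (balance-both (blockCount (suc (suc n')) s) _ _ (fulfilled TL) (fulfilled TU) (leaves TL) (leaves TU) (onlyLeftCount TL) (onlyLeftCount TU)
          blockCount-glue (ψ-blocks IHL) (ψ-blocks IHU))
      (crossings-both _ _ _ _ _ _ _ crossingCount-glue (ψ-crossings IHL) (ψ-crossings IHU) (proj₂ (glue-left-tree f'')))
  where
  open GlueCrossings G
  open GlueBlocks G
  open GlueLeftTree G
  TL = ψᴿ (suc f'') (suc (suc j)) s
  TU = ψᴿ (suc f'') m U
  IHL = ih (suc (suc j)) s (Glue-left-fuel le G) (s≤s z≤n) (g-equiv G) (Glue-left-noncrossing G nc)
  IHU = ih m U (≤-trans (m∸n≤m (suc n') (suc j)) (≤-pred le)) m-pos (shiftRel-equiv (suc j) (g-equiv G)) (NonCrossingᴿ-shift (suc j) Jm≤n nc)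

ψProps-step : ∀ f'' → ψPropsUpTo (suc f'') → ∀ n' s → suc (suc n') ≤ suc (suc f'') → IsEquivᵇ s → NonCrossingᴿ 2 (suc (suc n')) s → ∀ mb → LastPartnerView (suc (suc n')) s mb →
    ψProps (suc (suc n')) s (ψᴿ-step (suc f'') (suc (suc n')) s false mb)
ψProps-step f'' ih n' s le E nc nothing (no-partner none) =
  let IH = ih (suc n') s (≤-pred le) (s≤s z≤n) E (NonCrossingᴿ-restrict (n≤1+n _) nc)
      T' = ψᴿ (suc f'') (suc n') s
  in mkψProps (cong suc (ψ-unfulfilled IH)) (ψ-leftCond IH)
         (trans (cong (_+ fulfilled T') (trans (blockCount-last (suc n') s) (cong (λ b → blockCount (suc n') s + ind b) (opensBlock-true s (suc n') none))))
                (balance-onlyL (blockCount (suc n') s) (fulfilled T') (leaves T') (onlyLeftCount T') (ψ-blocks IH)))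
         (trans (crossingCount-dropLast (suc n') s (λ a b c cr → ≡false⇒¬≡true (none c (e-lt (c-e2 cr))) (e-same (c-e2 cr)))) (ψ-crossings IH))
ψProps-step f'' ih n' s le E nc (just j) (partner .j j< sj later) with suc (suc j) ≡ᵇ suc (suc n') in e
... | true =
  let IH = ih (suc n') s (≤-pred le) (s≤s z≤n) E (NonCrossingᴿ-restrict (n≤1+n _) nc)
      T' = ψᴿ (suc f'') (suc n') s
      ej = lastPartner-stdEdge {suc (suc n')} E j< sj later
      j≡ = suc-injective (suc-injective (≡ᵇ⇒≡′ e))
  in mkψProps (cong suc (ψ-unfulfilled IH)) (ψ-leftCond IH)
         (trans (cong (_+ fulfilled T') (trans (blockCount-last (suc n') s) (cong (λ b → blockCount (suc n') s + ind b) (opensBlock-false s j (suc n') j< sj))))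
                (balance-onlyR (blockCount (suc n') s) (fulfilled T') (leaves T') (onlyLeftCount T') (ψ-blocks IH)))
         (trans (crossingCount-dropLast (suc n') s (λ a b c cr →
             let c≡ = stdEdge-unique-left E (c-e2 cr) ej
             in <-irrefl refl (<-≤-trans (c-bd cr) (subst (_< _) (trans c≡ j≡) (c-cb cr)))))
           (ψ-crossings IH))
... | false = ψProps-case3 f'' ih n' s j le nc (Glue-fromNonCrossing E nc j< sj later (≤∧≢⇒< (<∸1⇒2+≤ j<) (≡ᵇ-false⇒≢ e)))

ψProps-fuel : ∀ f → ψPropsUpTo f
ψProps-fuel (suc f) (suc zero) s le _ E nc = mkψProps refl tt refl refl
ψProps-fuel (suc zero) (suc (suc n')) s (s≤s ()) _ E nc
ψProps-fuel (suc (suc f'')) (suc (suc n')) s le _ E nc = ψProps-step f'' (ψProps-fuel (suc f'')) n' s le E nc (lastPartnerᴿ (suc (suc n')) s) (lastPartnerView (suc (suc n')) s)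

countᵇ : (ℕ → Bool) → List ℕ → ℕ
countᵇ P [] = 0
countᵇ P (y ∷ ys) = ind (P y) + countᵇ P ys

length≡countᵇ : ∀ l → length l ≡ countᵇ (λ _ → true) l
length≡countᵇ [] = refl
length≡countᵇ (x ∷ l) = cong suc (length≡countᵇ l)

countᵇ-filter : ∀ P x ys → countᵇ P (filter (λ y → ¬? (x ≟ y)) ys) ≡ countᵇ (λ y → P y ∧ not (x ≡ᵇ y)) ys
countᵇ-filter P x [] = refl
countᵇ-filter P x (y ∷ ys) with x ≡ᵇ y
... | true = trans (countᵇ-filter P x ys) (cong (λ b → ind b + countᵇ (λ y → P y ∧ not (x ≡ᵇ y)) ys) (sym (∧-zeroʳ (P y))))
... | false = cong₂ _+_ (cong ind (sym (∧-identityʳ (P y)))) (countᵇ-filter P x ys)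

allᵇ-applyUpTo-suc : ∀ p i → allᵇ p (applyUpTo (λ x → suc x) i) ≡ allᵇ (λ k → p (suc k)) (upTo i)
allᵇ-applyUpTo-suc p i = trans (cong (allᵇ p) (sym (map-applyUpTo (λ x → x) suc i))) (allᵇ-map p suc (upTo i))

∧-rotate : ∀ a b c → ((a ∧ b) ∧ c) ≡ (b ∧ (c ∧ a))
∧-rotate true true true = refl
∧-rotate true true false = refl
∧-rotate true false c = refl
∧-rotate false true true = refl
∧-rotate false true false = refl
∧-rotate false false c = refl

countᵇ-deduplicate : ∀ P xs → countᵇ P (deduplicate _≟_ xs) ≡ sum< (length xs) (λ i → ind (opensBlock (sameBlock xs) i ∧ P (at xs i)))
countᵇ-deduplicate P [] = refl
countᵇ-deduplicate P (y ∷ ys) = cong (ind (P y) +_)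
  (trans (countᵇ-filter P y (deduplicate _≟_ ys))
  (trans (countᵇ-deduplicate (λ z → P z ∧ not (y ≡ᵇ z)) ys)
  (sum<-cong (length ys) _ _ λ i _ → cong ind (sym (trans (cong (λ b → (not (y ≡ᵇ at ys i) ∧ b) ∧ P (at ys i)) (allᵇ-applyUpTo-suc _ i)) (∧-rotate (not (y ≡ᵇ at ys i)) (opensBlock (sameBlock ys) i) (P (at ys i))))))))

numBlocks≡blockCount : ∀ w → numBlocks w ≡ blockCount (length w) (sameBlock w)
numBlocks≡blockCount w = trans (length≡countᵇ (deduplicate _≟_ w)) (trans (countᵇ-deduplicate (λ _ → true) w) (sum<-cong (length w) _ _ λ i _ → cong ind (∧-identityʳ _)))

-- Injectivity

eq-sym-≡ : ∀ {s} → IsEquivᵇ s → ∀ i j → s i j ≡ s j i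
eq-sym-≡ E i j = bool-ext (eq-sym E i j) (eq-sym E j i)

≈-extend-last : ∀ {s s' n'} → IsEquivᵇ s → IsEquivᵇ s' → s ≈⟨ n' ⟩ s' → (∀ i → i < n' → s i n' ≡ s' i n') → s ≈⟨ suc n' ⟩ s'
≈-extend-last {s} {s'} {n'} E E' h col i j (s≤s i≤) (s≤s j≤) with m≤n⇒m<n∨m≡n i≤ | m≤n⇒m<n∨m≡n j≤
... | inj₁ i< | inj₁ j< = h i j i< j<
... | inj₁ i< | inj₂ refl = col i i<
... | inj₂ refl | inj₁ j< = trans (eq-sym-≡ E i j) (trans (col j j<) (eq-sym-≡ E' j i))
... | inj₂ refl | inj₂ refl = trans (eq-refl E i) (sym (eq-refl E' i))

≈-from-upper : ∀ {s s' N} → IsEquivᵇ s → IsEquivᵇ s' → (∀ x y → x ≤ y → y < N → s x y ≡ s' x y) → s ≈⟨ N ⟩ s'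
≈-from-upper {s} {s'} E E' h x y x< y< with ≤-total x y
... | inj₁ x≤y = h x y x≤y y<
... | inj₂ y≤x = trans (eq-sym-≡ E x y) (trans (h y x y≤x x<) (eq-sym-≡ E' y x))

module GlueReconstruct {n s s' j} (G : Glue n s j) (G' : Glue n s' j) where
  open GlueCrossings G using (m; J<n-1)

  g-middle : ∀ {t} → Glue n t j → ∀ x y → x < suc j → suc j < y → y < n ∸ 1 → t x y ≡ (t x (suc j) ∧ t (suc j) y)
  g-middle {t} Gt x y x<J J<y y< = bool-ext
    (λ e → let eJy = g-nested Gt x y x<J J<y y< e in ∧-intro (eq-trans (g-equiv Gt) x y (suc j) e (eq-sym (g-equiv Gt) (suc j) y eJy)) eJy)
    (λ e → eq-trans (g-equiv Gt) x (suc j) y (∧-elimˡ e) (∧-elimʳ {t x (suc j)} e))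

  reconstruct : s ≈⟨ suc (suc j) ⟩ s' → shiftRel (suc j) s ≈⟨ m ⟩ shiftRel (suc j) s' → s ≈⟨ n ⟩ s'
  reconstruct hL hU = subst (λ k → s ≈⟨ k ⟩ s') n≡ (≈-extend-last (g-equiv G) (g-equiv G') inner col)
    where
    n≡ : suc (n ∸ 1) ≡ n
    n≡ = m+[n∸m]≡n {1} {n} (≤-trans (s≤s z≤n) (<⇒≤ (g-bound G)))
    uU : ∀ x y → suc j ≤ x → x ≤ y → y < n ∸ 1 → s x y ≡ s' x y
    uU x y jx x≤y y< = subst₂ (λ a b → s a b ≡ s' a b) (m+[n∸m]≡n jx) (m+[n∸m]≡n (≤-trans jx x≤y))
       (hU (x ∸ suc j) (y ∸ suc j) (∸-monoˡ-< (≤-<-trans x≤y y<) jx) (∸-monoˡ-< y< (≤-trans jx x≤y)))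
    inner : s ≈⟨ n ∸ 1 ⟩ s'
    inner = ≈-from-upper (g-equiv G) (g-equiv G') λ x y x≤y y< → case x y x≤y y<
      where
      case : ∀ x y → x ≤ y → y < n ∸ 1 → s x y ≡ s' x y
      case x y x≤y y< with y <? suc (suc j)
      ... | yes y<L = hL x y (≤-<-trans x≤y y<L) y<L
      ... | no y≮L with suc j ≤? x
      ...   | yes jx = uU x y jx x≤y y<
      ...   | no jx' = let x<J = ≰⇒> jx' ; J<y = ≮⇒≥ y≮L in
              trans (g-middle G x y x<J J<y y<)
              (trans (cong₂ _∧_ (hL x (suc j) (<-trans x<J (n<1+n _)) (n<1+n _)) (uU (suc j) y ≤-refl (<⇒≤ J<y) y<))
              (sym (g-middle G' x y x<J J<y y<)))
    col : ∀ i → i < n ∸ 1 → s i (n ∸ 1) ≡ s' i (n ∸ 1)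
    col i i< = trans (column-agree (g-equiv G) (e-same (g-edge G)) i)
                (trans (inner i j i< (<-trans (n<1+n j) J<n-1)) (sym (column-agree (g-equiv G') (e-same (g-edge G')) i)))

ψᴿ-InjectiveBelow : ℕ → Set
ψᴿ-InjectiveBelow f = ∀ n s s' → n ≤ f → IsEquivᵇ s → IsEquivᵇ s' → NonCrossingᴿ 2 n s → NonCrossingᴿ 2 n s' → ψᴿ f n s ≡ ψᴿ f n s' → s ≈⟨ n ⟩ s'

onlyL-injective : ∀ {a b} → onlyL a ≡ onlyL b → a ≡ b
onlyL-injective refl = refl
onlyR-injective : ∀ {a b} → onlyR a ≡ onlyR b → a ≡ b
onlyR-injective refl = refl
both-injective : ∀ {a b c d} → both a b ≡ both c d → a ≡ c × b ≡ d
both-injective refl = refl , refl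

Glue-left-size : ∀ {f n s j} → n ≤ suc f → Glue n s j → NonCrossingᴿ 2 n s →
  unfulfilled (ψᴿ f (suc (suc j)) s) ≡ suc (suc j)
Glue-left-size {f} le G nc =
  ψ-unfulfilled (ψProps-fuel f _ _ (Glue-left-fuel le G) (s≤s z≤n) (g-equiv G) (Glue-left-noncrossing G nc))

-- The left subtree has j + 2 unfulfilled vertices, so equal trees have the same split point.
ψᴿ-injective-case3 : ∀ f'' → ψᴿ-InjectiveBelow (suc f'') → ∀ n' s s' j j' → suc (suc n') ≤ suc (suc f'') →
  NonCrossingᴿ 2 (suc (suc n')) s → NonCrossingᴿ 2 (suc (suc n')) s' →
  Glue (suc (suc n')) s j → Glue (suc (suc n')) s' j' →
  both (ψᴿ (suc f'') (suc (suc j)) s) (ψᴿ (suc f'') (suc n' ∸ suc j) (shiftRel (suc j) s))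
    ≡ both (ψᴿ (suc f'') (suc (suc j')) s') (ψᴿ (suc f'') (suc n' ∸ suc j') (shiftRel (suc j') s')) →
  s ≈⟨ suc (suc n') ⟩ s'
ψᴿ-injective-case3 f'' ih n' s s' j j' le nc nc' G G' eq
  with refl ← suc-injective (suc-injective (trans (sym (Glue-left-size le G nc))
                (trans (cong unfulfilled (proj₁ (both-injective eq))) (Glue-left-size le G' nc')))) =
  GlueReconstruct.reconstruct G G'
    (ih (suc (suc j)) s s' (Glue-left-fuel le G) (g-equiv G) (g-equiv G')
        (Glue-left-noncrossing G nc) (Glue-left-noncrossing G' nc') (proj₁ (both-injective eq)))
    (ih (suc n' ∸ suc j) _ _ (≤-trans (m∸n≤m (suc n') (suc j)) (≤-pred le))
        (shiftRel-equiv (suc j) (g-equiv G)) (shiftRel-equiv (suc j) (g-equiv G'))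
        (NonCrossingᴿ-shift (suc j) (GlueCrossings.Jm≤n G) nc) (NonCrossingᴿ-shift (suc j) (GlueCrossings.Jm≤n G) nc')
        (proj₂ (both-injective eq)))

ψᴿ-injective-step : ∀ f'' → ψᴿ-InjectiveBelow (suc f'') → ∀ n' s s' → suc (suc n') ≤ suc (suc f'') → IsEquivᵇ s → IsEquivᵇ s' →
  NonCrossingᴿ 2 (suc (suc n')) s → NonCrossingᴿ 2 (suc (suc n')) s' → ∀ mb mb' → LastPartnerView (suc (suc n')) s mb → LastPartnerView (suc (suc n')) s' mb' →
  ψᴿ-step (suc f'') (suc (suc n')) s false mb ≡ ψᴿ-step (suc f'') (suc (suc n')) s' false mb' → s ≈⟨ suc (suc n') ⟩ s'
ψᴿ-injective-step f'' ih n' s s' le E E' nc nc' nothing nothing (no-partner none) (no-partner none') eq =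
  ≈-extend-last E E' (ih (suc n') s s' (≤-pred le) E E' (NonCrossingᴿ-restrict (n≤1+n _) nc) (NonCrossingᴿ-restrict (n≤1+n _) nc') (onlyL-injective eq))
    (λ i i< → trans (none i i<) (sym (none' i i<)))
ψᴿ-injective-step f'' ih n' s s' le E E' nc nc' nothing (just j') _ _ eq with suc (suc j') ≡ᵇ suc (suc n')
ψᴿ-injective-step f'' ih n' s s' le E E' nc nc' nothing (just j') _ _ () | true
ψᴿ-injective-step f'' ih n' s s' le E E' nc nc' nothing (just j') _ _ () | false
ψᴿ-injective-step f'' ih n' s s' le E E' nc nc' (just j) nothing _ _ eq with suc (suc j) ≡ᵇ suc (suc n')
ψᴿ-injective-step f'' ih n' s s' le E E' nc nc' (just j) nothing _ _ () | true
ψᴿ-injective-step f'' ih n' s s' le E E' nc nc' (just j) nothing _ _ () | false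
ψᴿ-injective-step f'' ih n' s s' le E E' nc nc' (just j) (just j') (partner .j j< sj later) (partner .j' j'< sj' later') eq
  with suc (suc j) ≡ᵇ suc (suc n') in e | suc (suc j') ≡ᵇ suc (suc n') in e'
... | true | true = ≈-extend-last E E' IH col
  where
  IH = ih (suc n') s s' (≤-pred le) E E' (NonCrossingᴿ-restrict (n≤1+n _) nc) (NonCrossingᴿ-restrict (n≤1+n _) nc') (onlyR-injective eq)
  j≡ = suc-injective (suc-injective (≡ᵇ⇒≡′ e))
  j≡' = suc-injective (suc-injective (≡ᵇ⇒≡′ e'))
  col : ∀ i → i < suc n' → s i (suc n') ≡ s' i (suc n')
  col i i< = trans (column-agree E (subst (λ z → s z (suc n') ≡ true) j≡ sj) i)
               (trans (IH i n' i< (n<1+n n')) (sym (column-agree E' (subst (λ z → s' z (suc n') ≡ true) j≡' sj') i)))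
... | true | false = ⊥-elim (cd eq)
  where
  cd : ∀ {a b c} → onlyR a ≢ both b c
  cd ()
... | false | true = ⊥-elim (cd eq)
  where
  cd : ∀ {a b c} → both b c ≢ onlyR a
  cd ()
... | false | false = ψᴿ-injective-case3 f'' ih n' s s' j j' le nc nc'
  (Glue-fromNonCrossing E nc j< sj later (≤∧≢⇒< (<∸1⇒2+≤ j<) (≡ᵇ-false⇒≢ e)))
  (Glue-fromNonCrossing E' nc' j'< sj' later' (≤∧≢⇒< (<∸1⇒2+≤ j'<) (≡ᵇ-false⇒≢ e'))) eq

ψᴿ-injective : ∀ f → ψᴿ-InjectiveBelow f
ψᴿ-injective f zero s s' _ _ _ _ _ _ i j ()
ψᴿ-injective f (suc zero) s s' _ E E' _ _ _ zero zero _ _ = trans (eq-refl E 0) (sym (eq-refl E' 0))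
ψᴿ-injective f (suc zero) s s' _ E E' _ _ _ zero (suc j) _ (s≤s ())
ψᴿ-injective f (suc zero) s s' _ E E' _ _ _ (suc i) j (s≤s ()) _
ψᴿ-injective (suc zero) (suc (suc n')) s s' (s≤s ()) E E' nc nc' eq
ψᴿ-injective (suc (suc f'')) (suc (suc n')) s s' le E E' nc nc' eq =
  ψᴿ-injective-step f'' (ψᴿ-injective (suc f'')) n' s s' le E E' nc nc' _ _ (lastPartnerView (suc (suc n')) s) (lastPartnerView (suc (suc n')) s') eq

-- Surjectivity

append-singleton : ∀ m s → 1 ≤ m → IsEquivᵇ s → NonCrossingᴿ 2 m s → (∀ i → i < m → s i m ≡ false) → NonCrossingᴿ 2 (suc m) s × ψᴿ (suc m) (suc m) s ≡ onlyL (ψᴿ m m s)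
append-singleton (suc m'') s _ E nc none = noncrossing , ψ-snoc
  where
  noncrossing : NonCrossingᴿ 2 (suc (suc m'')) s
  noncrossing a b c d cr with d ≟ suc m''
  ... | yes refl = ≡false⇒¬≡true (none c (e-lt (c-e2 cr))) (e-same (c-e2 cr))
  ... | no d≢ = nc a b c d (Crossing-restrict (≤∧≢⇒< (≤-pred (e-bd (c-e2 cr))) d≢) cr)
  ψ-snoc : ψᴿ (suc (suc m'')) (suc (suc m'')) s ≡ onlyL (ψᴿ (suc m'') (suc m'') s)
  ψ-snoc rewrite lastPartner≡nothing (suc (suc m'')) s none = refl

append-joining-last : ∀ m s → 1 ≤ m → IsEquivᵇ s → NonCrossingᴿ 2 m s → s (m ∸ 1) m ≡ true → NonCrossingᴿ 2 (suc m) s × ψᴿ (suc m) (suc m) s ≡ onlyR (ψᴿ m m s)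
append-joining-last (suc m'') s _ E nc e = noncrossing , ψ-snoc
  where
  ed : StdEdge (suc (suc m'')) s m'' (suc m'')
  ed = lastPartner-stdEdge E (n<1+n m'') e (λ i lo hi → ⊥-elim (<-irrefl refl (<-≤-trans lo (≤-pred hi))))
  noncrossing : NonCrossingᴿ 2 (suc (suc m'')) s
  noncrossing a b c d cr with d ≟ suc m''
  ... | yes refl = <-irrefl refl (<-≤-trans (c-bd cr) (subst (_< b) (stdEdge-unique-left E (c-e2 cr) ed) (c-cb cr)))
  ... | no d≢ = nc a b c d (Crossing-restrict (≤∧≢⇒< (≤-pred (e-bd (c-e2 cr))) d≢) cr)
  ψ-snoc : ψᴿ (suc (suc m'')) (suc (suc m'')) s ≡ onlyR (ψᴿ (suc m'') (suc m'') s)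
  ψ-snoc rewrite lastPartner≡just (suc (suc m'')) s m'' (n<1+n m'') e (λ i lo hi → ⊥-elim (<-irrefl refl (<-≤-trans lo (≤-pred hi)))) | ≡ᵇ-refl m'' = refl

ψᴿ-glue : ∀ n s j → Glue n s j → ψᴿ n n s ≡ both (ψᴿ (suc (suc j)) (suc (suc j)) s) (ψᴿ (n ∸ 1 ∸ suc j) (n ∸ 1 ∸ suc j) (shiftRel (suc j) s))
ψᴿ-glue (suc (suc n'')) s j G
  rewrite lastPartner≡just (suc (suc n'')) s j (e-lt (g-edge G)) (e-same (g-edge G))
            (λ i lo hi → trans (column-agree (g-equiv G) (e-same (g-edge G)) i) (e-gap (g-edge G) i lo hi))
        | ≢⇒≡ᵇ-false (<⇒≢ (g-bound G))
  = cong₂ both (ψᴿ-fuel-irrelevant (suc n'') (suc (suc j)) _ s (≤-pred (g-bound G)) ≤-refl)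
               (ψᴿ-fuel-irrelevant (suc n'') (suc n'' ∸ suc j) _ (shiftRel (suc j) s) (m∸n≤m (suc n'') (suc j)) ≤-refl)

-- Doubling labels leaves the odd ones free for fresh blocks.
double : ℕ → ℕ
double zero = 0
double (suc n) = suc (suc (double n))

double-injective : ∀ a b → double a ≡ double b → a ≡ b
double-injective zero zero _ = refl
double-injective (suc a) (suc b) e = cong suc (double-injective a b (suc-injective (suc-injective e)))

double≢odd : ∀ a b → double a ≢ suc (double b)
double≢odd (suc a) (suc b) e = double≢odd a b (suc-injective (suc-injective e))
double≢odd zero b ()
double≢odd (suc zero) zero ()
double≢odd (suc (suc a)) zero ()

<ᵇ-false : ∀ {x m} → m ≤ x → (x <ᵇ m) ≡ false
<ᵇ-false m≤x = ¬≡true⇒≡false λ e → <-irrefl refl (<-≤-trans (<ᵇ⇒<′ e) m≤x)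

unfulfilled-positive : ∀ t → 1 ≤ unfulfilled t
unfulfilled-positive leaf = s≤s z≤n
unfulfilled-positive (onlyL t) = s≤s z≤n
unfulfilled-positive (onlyR t) = s≤s z≤n
unfulfilled-positive (both l r) = ≤-trans (unfulfilled-positive l) (m≤m+n _ _)

HasLeftChild⇒2≤unfulfilled : ∀ t → HasLeftChild t → 2 ≤ unfulfilled t
HasLeftChild⇒2≤unfulfilled (onlyL t) _ = s≤s (unfulfilled-positive t)
HasLeftChild⇒2≤unfulfilled (both l r) _ = +-mono-≤ (unfulfilled-positive l) (unfulfilled-positive r)

HasLeftChild⇒no-last-edge : ∀ j s l → ψᴿ (suc (suc j)) (suc (suc j)) s ≡ l → HasLeftChild l → s j (suc j) ≡ false
HasLeftChild⇒no-last-edge j s l eq hl with s j (suc j) in e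
... | false = refl
... | true rewrite lastPartner≡just (suc (suc j)) s j (n<1+n j) e (λ i lo hi → ⊥-elim (<-irrefl refl (<-≤-trans lo (≤-pred hi)))) | ≡ᵇ-refl j
  with l | eq
... | onlyR _ | refl = ⊥-elim hl

record Realisable (t : Tree) : Set where
  constructor mkRealisable
  field
    labelling : ℕ → ℕ
    realised-noncrossing : NonCrossingᴿ 2 (unfulfilled t) (sameLabel labelling)
    realised-ψ : ψᴿ (unfulfilled t) (unfulfilled t) (sameLabel labelling) ≡ t

realise-leaf : Realisable leaf
realise-leaf = mkRealisable (λ _ → 0) (λ a b c d cr → case ≤-trans (c-bd cr) (≤-pred (e-bd (c-e2 cr))) of λ ()) refl

realisable-onlyL : ∀ t → Realisable t → Realisable (onlyL t)
realisable-onlyL t (mkRealisable labelling nc ψeq) = mkRealisable lab' (proj₁ res) (trans (proj₂ res) (cong onlyL (trans (ψᴿ-cong m m s (sameLabel labelling) h) ψeq)))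
  where
  m = unfulfilled t
  lab' : ℕ → ℕ
  lab' x = if x <ᵇ m then double (labelling x) else 1
  s = sameLabel lab'
  h : s ≈⟨ m ⟩ sameLabel labelling
  h x y x< y< = trans (cong₂ _≡ᵇ_ (if-true (<⇒<ᵇ′ x<)) (if-true (<⇒<ᵇ′ y<))) (≡ᵇ-cong-⇔ (double-injective (labelling x) (labelling y)) (cong double))
  none : ∀ i → i < m → s i m ≡ false
  none i i< = trans (cong₂ _≡ᵇ_ (if-true (<⇒<ᵇ′ i<)) (if-false (<ᵇ-false (≤-refl {m})))) (≢⇒≡ᵇ-false (double≢odd (labelling i) 0))
  res = append-singleton m s (unfulfilled-positive t) (sameLabel-equiv lab') (NonCrossingᴿ-cong (≈-sym h) nc) none

realisable-onlyR : ∀ t → Realisable t → Realisable (onlyR t)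
realisable-onlyR t (mkRealisable labelling nc ψeq) = mkRealisable lab' (proj₁ res) (trans (proj₂ res) (cong onlyR (trans (ψᴿ-cong m m s (sameLabel labelling) h) ψeq)))
  where
  m = unfulfilled t
  lab' : ℕ → ℕ
  lab' x = if x <ᵇ m then labelling x else labelling (m ∸ 1)
  s = sameLabel lab'
  h : s ≈⟨ m ⟩ sameLabel labelling
  h x y x< y< = cong₂ _≡ᵇ_ (if-true (<⇒<ᵇ′ x<)) (if-true (<⇒<ᵇ′ y<))
  m-1< : m ∸ 1 < m
  m-1< = pl m (unfulfilled-positive t)
    where
    pl : ∀ m → 1 ≤ m → m ∸ 1 < m
    pl (suc m) _ = ≤-refl
  lst : s (m ∸ 1) m ≡ true
  lst = trans (cong₂ _≡ᵇ_ (if-true (<⇒<ᵇ′ m-1<)) (if-false (<ᵇ-false (≤-refl {m})))) (≡ᵇ-refl (labelling (m ∸ 1)))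
  res = append-joining-last m s (unfulfilled-positive t) (sameLabel-equiv lab') (NonCrossingᴿ-cong (≈-sym h) nc) lst

-- The right part is relabelled to odd labels, except that its first position takes the label of
-- the left part's last position; the final position rejoins the block of j.
module GlueLabelling (j : ℕ) (l r : Tree) (hl : HasLeftChild l) (labL labR : ℕ → ℕ)
  (ncL : NonCrossingᴿ 2 (suc (suc j)) (sameLabel labL)) (ψL : ψᴿ (suc (suc j)) (suc (suc j)) (sameLabel labL) ≡ l)
  (ncR : NonCrossingᴿ 2 (unfulfilled r) (sameLabel labR)) (ψR : ψᴿ (unfulfilled r) (unfulfilled r) (sameLabel labR) ≡ r) where

  m = unfulfilled r
  n = suc (suc j) + m

  relabelRight : ℕ → ℕ
  relabelRight v = if v ≡ᵇ labR 0 then double (labL (suc j)) else suc (double v)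

  gluedLabelling : ℕ → ℕ
  gluedLabelling x = if x <ᵇ suc (suc j) then double (labL x) else (if x <ᵇ n ∸ 1 then relabelRight (labR (x ∸ suc j)) else double (labL j))

  s = sameLabel gluedLabelling

  left-last-apart : labL j ≢ labL (suc j)
  left-last-apart = ≡ᵇ-false⇒≢ (HasLeftChild⇒no-last-edge j (sameLabel labL) l ψL hl)

  lab-left : ∀ x → x < suc (suc j) → gluedLabelling x ≡ double (labL x)
  lab-left x x< = if-true (<⇒<ᵇ′ x<)

  lab-middle : ∀ x → suc (suc j) ≤ x → x < n ∸ 1 → gluedLabelling x ≡ relabelRight (labR (x ∸ suc j))
  lab-middle x le x< = trans (if-false (<ᵇ-false le)) (if-true (<⇒<ᵇ′ x<))

  left-fits : suc (suc j) ≤ suc j + m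
  left-fits = subst (_≤ suc j + m) (+-comm (suc j) 1) (+-monoʳ-≤ (suc j) (unfulfilled-positive r))

  lab-last : gluedLabelling (n ∸ 1) ≡ double (labL j)
  lab-last = trans (if-false (<ᵇ-false left-fits)) (if-false (<ᵇ-false (≤-refl {n ∸ 1})))


  lab-right : ∀ y → y < m → gluedLabelling (suc j + y) ≡ relabelRight (labR y)
  lab-right zero _ = trans (cong gluedLabelling (+-identityʳ (suc j))) (trans (lab-left (suc j) (n<1+n _)) (sym (if-true (≡ᵇ-refl (labR 0)))))
  lab-right (suc y) y< = trans (lab-middle (suc j + suc y) (subst (suc (suc j) ≤_) (sym (+-suc (suc j) y)) (s≤s (m≤m+n (suc j) y))) (+-monoʳ-< (suc j) y<))
                          (cong (λ z → relabelRight (labR z)) (m+n∸m≡n (suc j) (suc y)))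

  relabelRight-pattern : ∀ a b → (relabelRight a ≡ᵇ relabelRight b) ≡ (a ≡ᵇ b)
  relabelRight-pattern a b with a ≡ᵇ labR 0 in ea | b ≡ᵇ labR 0 in eb
  ... | true | true = trans (≡ᵇ-refl (double (labL (suc j)))) (sym (≡⇒≡ᵇ′ {a} {b} (trans (≡ᵇ⇒≡′ {a} {labR 0} ea) (sym (≡ᵇ⇒≡′ {b} {labR 0} eb)))))
  ... | true | false = trans (≢⇒≡ᵇ-false {double (labL (suc j))} {suc (double b)} (double≢odd (labL (suc j)) b)) (sym (≢⇒≡ᵇ-false {a} {b} λ a≡b → ≡ᵇ-false⇒≢ {b} {labR 0} eb (trans (sym a≡b) (≡ᵇ⇒≡′ {a} {labR 0} ea))))
  ... | false | true = trans (≢⇒≡ᵇ-false {suc (double a)} {double (labL (suc j))} (λ e → double≢odd (labL (suc j)) a (sym e))) (sym (≢⇒≡ᵇ-false {a} {b} λ a≡b → ≡ᵇ-false⇒≢ {a} {labR 0} ea (trans a≡b (≡ᵇ⇒≡′ {b} {labR 0} eb))))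
  ... | false | false = ≡ᵇ-cong-⇔ {suc (double a)} {suc (double b)} {a} {b} (λ e → double-injective a b (suc-injective e)) (cong (λ z → suc (double z)))

  relabelRight-values : ∀ v → relabelRight v ≡ double (labL (suc j)) ⊎ Σ ℕ (λ w → relabelRight v ≡ suc (double w))
  relabelRight-values v with v ≡ᵇ labR 0
  ... | true = inj₁ refl
  ... | false = inj₂ (v , refl)

  left-agrees : s ≈⟨ suc (suc j) ⟩ sameLabel labL
  left-agrees x y x< y< = trans (cong₂ _≡ᵇ_ (lab-left x x<) (lab-left y y<)) (≡ᵇ-cong-⇔ {double (labL x)} {double (labL y)} {labL x} {labL y} (double-injective _ _) (cong double))

  right-agrees : shiftRel (suc j) s ≈⟨ m ⟩ sameLabel labR
  right-agrees x y x< y< = trans (cong₂ _≡ᵇ_ (lab-right x x<) (lab-right y y<)) (relabelRight-pattern (labR x) (labR y))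

  j<n1 : j < n ∸ 1
  j<n1 = <-trans (n<1+n j) left-fits

  last-joins-j : s j (n ∸ 1) ≡ true
  last-joins-j = trans (cong₂ _≡ᵇ_ (lab-left j (<-trans (n<1+n j) (n<1+n (suc j)))) lab-last) (≡ᵇ-refl (double (labL j)))

  no-later-partner : ∀ i → j < i → i < n ∸ 1 → s i (n ∸ 1) ≡ false
  no-later-partner i j<i i< with suc (suc j) ≤? i
  ... | no ni = trans (cong₂ _≡ᵇ_ (trans (cong gluedLabelling (sym i≡)) (lab-left (suc j) (n<1+n _))) lab-last)
                      (≢⇒≡ᵇ-false {double (labL (suc j))} {double (labL j)} (λ e → left-last-apart (sym (double-injective _ _ e))))
    where
    i≡ : suc j ≡ i
    i≡ = ≤-antisym j<i (≤-pred (≰⇒> ni))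
  ... | yes ji with relabelRight-values (labR (i ∸ suc j))
  ...   | inj₁ eq = trans (cong₂ _≡ᵇ_ (trans (lab-middle i ji i<) eq) lab-last) (≢⇒≡ᵇ-false {double (labL (suc j))} {double (labL j)} (λ e → left-last-apart (sym (double-injective _ _ e))))
  ...   | inj₂ (w , eq) = trans (cong₂ _≡ᵇ_ (trans (lab-middle i ji i<) eq) lab-last) (≢⇒≡ᵇ-false {suc (double w)} {double (labL j)} (λ e → double≢odd _ _ (sym e)))

  nested : ∀ x y → x < suc j → suc j < y → y < n ∸ 1 → s x y ≡ true → s (suc j) y ≡ true
  nested x y x<J J<y y< e with relabelRight-values (labR (y ∸ suc j))
  ... | inj₁ eq = trans (cong₂ _≡ᵇ_ (lab-left (suc j) (n<1+n _)) (trans (lab-middle y J<y y<) eq)) (≡ᵇ-refl (double (labL (suc j))))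
  ... | inj₂ (w , eq) = ⊥-elim (double≢odd (labL x) w (trans (sym (lab-left x (<-trans x<J (n<1+n _)))) (trans (≡ᵇ⇒≡′ {gluedLabelling x} {gluedLabelling y} e) (trans (lab-middle y J<y y<) eq))))

  glue : Glue n s j
  glue = mkG (sameLabel-equiv gluedLabelling) (m<m+n (suc (suc j)) (unfulfilled-positive r)) (lastPartner-stdEdge (sameLabel-equiv gluedLabelling) j<n1 last-joins-j no-later-partner) nested

  rightSize : n ∸ 1 ∸ suc j ≡ m
  rightSize = m+n∸m≡n (suc j) m

  right-agrees′ : shiftRel (suc j) s ≈⟨ n ∸ 1 ∸ suc j ⟩ sameLabel labR
  right-agrees′ = subst (λ k → shiftRel (suc j) s ≈⟨ k ⟩ sameLabel labR) (sym rightSize) right-agrees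

  glued-noncrossing : NonCrossingᴿ 2 n s
  glued-noncrossing = GlueCrossings.NonCrossing-glue glue (NonCrossingᴿ-cong (≈-sym left-agrees) ncL) (NonCrossingᴿ-cong (≈-sym right-agrees′) (subst (λ k → NonCrossingᴿ 2 k (sameLabel labR)) (sym rightSize) ncR))

  ψ-glued : ψᴿ n n s ≡ both l r
  ψ-glued = trans (ψᴿ-glue n s j glue) (cong₂ both (trans (ψᴿ-cong _ _ _ _ left-agrees) ψL)
         (trans (cong (λ k → ψᴿ k k (shiftRel (suc j) s)) rightSize) (trans (ψᴿ-cong m m _ _ right-agrees) ψR)))

realisable-both : ∀ l r → HasLeftChild l → Realisable l → Realisable r → Realisable (both l r)
realisable-both l r hl (mkRealisable labL ncL ψL) (mkRealisable labR ncR ψR) =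
  glue (unfulfilled l) refl (HasLeftChild⇒2≤unfulfilled l hl) ncL ψL
  where
  glue : ∀ i → unfulfilled l ≡ i → 2 ≤ i → NonCrossingᴿ 2 i (sameLabel labL) → ψᴿ i i (sameLabel labL) ≡ l →
    Realisable (both l r)
  glue (suc (suc j)) size-l _ ncL′ ψL′ =
    mkRealisable gluedLabelling
      (subst (λ k → NonCrossingᴿ 2 (k + unfulfilled r) (sameLabel gluedLabelling)) (sym size-l) glued-noncrossing)
      (subst (λ k → ψᴿ (k + unfulfilled r) (k + unfulfilled r) (sameLabel gluedLabelling) ≡ both l r) (sym size-l) ψ-glued)
    where open GlueLabelling j l r hl labL labR ncL′ ψL′ ncR ψR
  glue (suc zero) _ (s≤s ()) _ _

realisable : ∀ t → LeftCond t → Realisable t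
realisable leaf _ = realise-leaf
realisable (onlyL t) lc = realisable-onlyL t (realisable t lc)
realisable (onlyR t) lc = realisable-onlyR t (realisable t lc)
realisable (both l r) (hl , lcl , lcr) = realisable-both l r hl (realisable l lcl) (realisable r lcr)

open import Data.Integer using (+_; _-_; _⊖_)
import Data.Integer
import Data.Integer.Properties as ℤ

at-applyUpTo : ∀ (l : ℕ → ℕ) N x → x < N → at (applyUpTo l N) x ≡ l x
at-applyUpTo l (suc N) zero _ = refl
at-applyUpTo l (suc N) (suc x) (s≤s x<) = at-applyUpTo (λ y → l (suc y)) N x x<

ℤ-rearrange : ∀ b f l o → b + f ≡ l + o → (+ b) ≡ (+ l) Data.Integer.+ (+ o) - (+ f)
ℤ-rearrange b f l o h = sym (begin
    (+ l) Data.Integer.+ (+ o) - (+ f)  ≡⟨ cong (_- (+ f)) (sym (ℤ.pos-+ l o)) ⟩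
    (+ (l + o)) - (+ f)                ≡⟨ ℤ.[+m]-[+n]≡m⊖n (l + o) f ⟩
    (l + o) ⊖ f                        ≡⟨ cong (_⊖ f) (sym h) ⟩
    (b + f) ⊖ f                        ≡⟨ ℤ.⊖-≥ (m≤n+m f b) ⟩
    + (b + f ∸ f)                      ≡⟨ cong +_ (m+n∸n≡m b f) ⟩
    + b                                ∎)
  where open ≡-Reasoning

ψ≡ψᴿ : ∀ w → ψ w ≡ ψᴿ (length w) (length w) (sameBlock w)
ψ≡ψᴿ w = ψ-go≡ψᴿ (length w) w

ψ-properties : ∀ w → 1 ≤ length w → NonCrossing 2 w → ψProps (length w) (sameBlock w) (ψ w)
ψ-properties w 1≤n nc =
  subst (ψProps (length w) (sameBlock w)) (sym (ψ≡ψᴿ w))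
    (ψProps-fuel (length w) (length w) (sameBlock w) ≤-refl 1≤n (sameLabel-equiv (at w)) (NonCrossing⇒ᴿ 2 w nc))

ψᴿ-injective′ : ∀ {N N′} s s′ → N ≡ N′ → IsEquivᵇ s → IsEquivᵇ s′ →
  NonCrossingᴿ 2 N s → NonCrossingᴿ 2 N′ s′ → ψᴿ N N s ≡ ψᴿ N′ N′ s′ → s ≈⟨ N ⟩ s′
ψᴿ-injective′ {N} s s′ refl = ψᴿ-injective N N s s′ ≤-refl

ψ-injective : ∀ {n} w w′ → IsPartition n w → NonCrossing 2 w → IsPartition n w′ → NonCrossing 2 w′ →
  ψ w ≡ ψ w′ → w ≡ w′
ψ-injective w w′ (refl , rgs) nc (len′ , rgs′) nc′ eq =
  RGS-unique 0 w w′ rgs rgs′ (sym len′) same-blocks (λ _ _ _ ())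
  where
  same-blocks : sameBlock w ≈⟨ length w ⟩ sameBlock w′
  same-blocks = ψᴿ-injective′ (sameBlock w) (sameBlock w′) (sym len′)
    (sameLabel-equiv (at w)) (sameLabel-equiv (at w′)) (NonCrossing⇒ᴿ 2 w nc) (NonCrossing⇒ᴿ 2 w′ nc′)
    (trans (sym (ψ≡ψᴿ w)) (trans eq (ψ≡ψᴿ w′)))

ψ-surjective : ∀ {n} t → unfulfilled t ≡ n → LeftCond t →
  Σ (List ℕ) λ w → IsPartition n w × NonCrossing 2 w × ψ w ≡ t
ψ-surjective t refl lc =
  w , (length-w , standardize-RGS v) , ᴿ⇒NonCrossing 2 w noncrossing , ψw≡t
  where
  open Realisable (realisable t lc)
  N = unfulfilled t
  v = applyUpTo labelling N
  w = standardize v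
  length-v : length v ≡ N
  length-v = length-applyUpTo labelling N
  length-w : length w ≡ N
  length-w = trans (standardize-length v) length-v
  same-blocks : sameBlock w ≈⟨ N ⟩ sameLabel labelling
  same-blocks x y x< y< =
    trans (sameBlock-standardize v x y (subst (x <_) (sym length-v) x<) (subst (y <_) (sym length-v) y<))
          (cong₂ _≡ᵇ_ (at-applyUpTo labelling N x x<) (at-applyUpTo labelling N y y<))
  noncrossing : NonCrossingᴿ 2 (length w) (sameBlock w)
  noncrossing = subst (λ k → NonCrossingᴿ 2 k (sameBlock w)) (sym length-w)
                  (NonCrossingᴿ-cong (≈-sym same-blocks) realised-noncrossing)
  ψw≡t : ψ w ≡ t
  ψw≡t = begin
    ψ w                              ≡⟨ ψ≡ψᴿ w ⟩
    ψᴿ (length w) (length w) (sameBlock w) ≡⟨ cong (λ k → ψᴿ k k (sameBlock w)) length-w ⟩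
    ψᴿ N N (sameBlock w)             ≡⟨ ψᴿ-cong N N _ _ same-blocks ⟩
    ψᴿ N N (sameLabel labelling)     ≡⟨ realised-ψ ⟩
    t                                ∎
    where open ≡-Reasoning

ψ-statistics : ∀ w → 1 ≤ length w → NonCrossing 2 w →
  ((+ numBlocks w) ≡ (+ leaves (ψ w)) Data.Integer.+ (+ onlyLeftCount (ψ w)) - (+ fulfilled (ψ w)))
  × (numCrossings 1 w ≡ leftFulfilledPairs (ψ w))
ψ-statistics w 1≤n nc =
  trans (cong +_ (numBlocks≡blockCount w))
        (ℤ-rearrange _ (fulfilled (ψ w)) (leaves (ψ w)) (onlyLeftCount (ψ w)) (ψ-blocks P)) ,
  trans (length-filterᵇ-quads (length w) _) (ψ-crossings P)
  where
  P = ψ-properties w 1≤n nc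

theorem3p2 : (n : ℕ) → 1 ≤ n →
    ((w : List ℕ) → IsPartition n w → NonCrossing 2 w →
    (unfulfilled (ψ w) ≡ n) × LeftCond (ψ w))
    × ((w w′ : List ℕ) → IsPartition n w → NonCrossing 2 w →
    IsPartition n w′ → NonCrossing 2 w′ → ψ w ≡ ψ w′ → w ≡ w′)
    × ((t : Tree) → unfulfilled t ≡ n → LeftCond t →
    Σ (List ℕ) (λ w → IsPartition n w × NonCrossing 2 w × ψ w ≡ t))
    × ((w : List ℕ) → IsPartition n w → NonCrossing 2 w →
    ((+ numBlocks w) ≡ (+ leaves (ψ w)) Data.Integer.+ (+ onlyLeftCount (ψ w)) - (+ fulfilled (ψ w)))
    × (numCrossings 1 w ≡ leftFulfilledPairs (ψ w)))
theorem3p2 n 1≤n = shape , ψ-injective , ψ-surjective , statistics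
  where
  shape : (w : List ℕ) → IsPartition n w → NonCrossing 2 w → (unfulfilled (ψ w) ≡ n) × LeftCond (ψ w)
  shape w (refl , _) nc = ψ-unfulfilled P , ψ-leftCond P
    where P = ψ-properties w 1≤n nc
  statistics : (w : List ℕ) → IsPartition n w → NonCrossing 2 w →
    ((+ numBlocks w) ≡ (+ leaves (ψ w)) Data.Integer.+ (+ onlyLeftCount (ψ w)) - (+ fulfilled (ψ w)))
    × (numCrossings 1 w ≡ leftFulfilledPairs (ψ w))
  statistics w (refl , _) = ψ-statistics w 1≤n
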